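{- Let $n,m,d$ be integers with $5\le m\le n-2$ and $3\le d\le n-\lfloor\frac{m+1}{2}\rfloor$, and let $a,b$ be integers with $a+b=d-\lfloor\frac m2\rfloor$, $a\ge b\ge0$ and $a\ge1$. Then ${}^rD'(U_{n,m,d}(a,b))<{}^rD'(U_{n,m-2,d+1}(a+1,b+1))$.
   Context: All graphs are finite, simple and connected. For a graph $G$, $d_G(x,y)$ is the distance, $D_G(x)=\sum_{y}d_G(x,y)$, $d_G(x)$ the degree, and $D'(G)=\sum_{x}d_G(x)D_G(x)$ the degree distance. The reverse degree distance of a graph $G$ with $n$ vertices, $e$ edges and diameter $d$ is ${}^rD'(G)=2(n-1)ed-D'(G)$. Attaching a path $P_s$ ($s\ge1$) to $w$ means adding new vertices $w_1,\dots,w_s$ with edges $ww_1,w_1w_2,\dots,w_{s-1}w_s$ (nothing for $s=0$); attaching $h$ pendant vertices to $w$ means adding $h$ new vertices each joined only to $w$. For integers $n,m,d$ and integers $a\ge b\ge0$ with $a\ge1$ and $a+b=d-\lfloor\frac m2\rfloor$, $U_{n,m,d}(a,b)$ is the unicyclic graph obtained from the cycle $C_m=v_0v_1\cdots v_{m-1}v_0$ by attaching a path $P_a$ to $v_0$, a path $P_b$ to $v_{\lfloor m/2\rfloor}$, and $n-d-\lfloor\frac{m+1}{2}\rfloor$ pendant vertices to $v_0$. -}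

module Defs where

open import Data.Nat using (ℕ; zero; suc; _+_; _*_; _∸_; _/_; _≡ᵇ_; _<ᵇ_; _⊔_)
open import Data.Bool using (Bool; true; false; _∧_; _∨_; if_then_else_)
open import Data.List using (List; []; _∷_; _++_; map; foldr; upTo)
open import Data.Nat.ListAction using (sum)
open import Data.Bool.ListAction using (any)
open import Data.Product using (_×_; _,_)
open import Data.Integer using (ℤ; +_; _-_)

-- A finite simple graph: vertex set {0,…,n-1}, given by a list of (undirected) edges.
record Graph : Set where
  constructor graph
  field
    order : ℕ
    edgeList : List (ℕ × ℕ)

open Graph public

adj : Graph → ℕ → ℕ → Bool
adj G x y = any (λ { (u , v) → ((u ≡ᵇ x) ∧ (v ≡ᵇ y)) ∨ ((u ≡ᵇ y) ∧ (v ≡ᵇ x)) }) (edgeList G)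

vertices : Graph → List ℕ
vertices G = upTo (order G)

countB : {A : Set} → (A → Bool) → List A → ℕ
countB p [] = 0
countB p (x ∷ xs) = (if p x then 1 else 0) + countB p xs

within : Graph → ℕ → ℕ → ℕ → Bool
within G zero x y = x ≡ᵇ y
within G (suc k) x y =
  within G k x y ∨ any (λ z → within G k x z ∧ adj G z y) (vertices G)

searchDist : Graph → ℕ → ℕ → ℕ → ℕ → ℕ
searchDist G k zero x y = k
searchDist G k (suc fuel) x y =
  if within G k x y then k else searchDist G (suc k) fuel x y

-- distance d_G(x,y): the least k with a walk of length k from x to y
-- (in a connected graph on n vertices this is < n, so the search over 0..n suffices)
dist : Graph → ℕ → ℕ → ℕ
dist G x y = searchDist G 0 (order G) x y

transmission : Graph → ℕ → ℕ
transmission G x = sum (map (dist G x) (vertices G))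

degree : Graph → ℕ → ℕ
degree G x = countB (adj G x) (vertices G)

edgeCount : Graph → ℕ
edgeCount G = sum (map (λ x → countB (λ y → (x <ᵇ y) ∧ adj G x y) (vertices G)) (vertices G))

diameter : Graph → ℕ
diameter G = foldr _⊔_ 0 (map (λ x → foldr _⊔_ 0 (map (dist G x) (vertices G))) (vertices G))

degreeDistance : Graph → ℕ
degreeDistance G = sum (map (λ x → degree G x * transmission G x) (vertices G))

reverseDegreeDistance : Graph → ℤ
reverseDegreeDistance G =
  (+ (2 * (order G ∸ 1) * edgeCount G * diameter G)) - (+ degreeDistance G)

-- Vertex labels: cycle v_i = i (0 ≤ i < m); path P_a at v_0 uses m,…,m+a-1;
-- path P_b at v_{⌊m/2⌋} uses m+a,…,m+a+b-1; pendant vertices m+a+b,…,n-1 joined to v_0.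

cycleEdges : ℕ → List (ℕ × ℕ)
cycleEdges m = map (λ i → (i , suc i)) (upTo (m ∸ 1)) ++ ((m ∸ 1 , 0) ∷ [])

pathEdges : ℕ → ℕ → ℕ → List (ℕ × ℕ)
pathEdges w start zero = []
pathEdges w start (suc s) = (w , start) ∷ pathEdges start (suc start) s

pendantEdges : ℕ → ℕ → ℕ → List (ℕ × ℕ)
pendantEdges w start h = map (λ j → (w , start + j)) (upTo h)

U : ℕ → ℕ → ℕ → ℕ → ℕ → Graph
U n m d a b = graph n
  (cycleEdges m
   ++ pathEdges 0 m a
   ++ pathEdges (m / 2) (m + a) b
   ++ pendantEdges 0 (m + a + b) (n ∸ d ∸ ((m + 1) / 2)))

-- Write m = 2h + r with r ≤ 1, and let q = n − d − ⌈m/2⌉ be the number of pendant vertices. Give every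
-- vertex of U a parent (its predecessor on the cycle, or its neighbour towards the cycle): the edges of U
-- are exactly the pairs {parent v, v}, so e = n, deg v = 1 + #children(v) and D'(U) = Σ_v (D(v) + D(parent v)).
-- The distances of U are given by an explicit formula, checked against the breadth-first characterisation
-- of the distance; from it the diameter is a + b + h = d and 3 D'(U) + 6q is an explicit polynomial in
-- h, r, a, b, q. Going from U_{n,m,d}(a,b) to U_{n,m-2,d+1}(a+1,b+1) keeps n and q and raises the diameter
-- by one; three times the difference of the reverse degree distances is then a polynomial in h − 2, r, a,
-- b, q with positive coefficients.

module Submission where

open import Defs
open import Data.Nat using (ℕ; zero; suc; pred; _+_; _*_; _∸_; _/_; _%_; _≤_; _≥_; _<_; _⊔_; _⊓_; ∣_-_∣; _≡ᵇ_; _<ᵇ_;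
                           z≤n; s≤s; z<s; s<s; _<?_; _≤?_; _≟_)
open import Data.Nat.Properties
open import Data.Nat.DivMod using (m≡m%n+[m/n]*n; m%n<n; m/n≡1+[m∸n]/n)
open import Data.Nat.ListAction using (sum)
open import Data.Nat.Tactic.RingSolver using (solve-∀)
open import Data.Nat.Solver using (module +-*-Solver)
open +-*-Solver using (solve; _:=_; _:+_; _:*_; con; Polynomial)
open import Data.Integer as ℤ using (ℤ) renaming (_<_ to _<ℤ_)
import Data.Integer.Properties as ℤ
open import Data.Integer.Tactic.RingSolver using () renaming (solve-∀ to solve-∀ℤ)
open import Data.Bool using (Bool; true; false; _∧_; _∨_; if_then_else_)
open import Data.Bool.Properties using (∨-zeroʳ)
open import Data.Bool.ListAction using (any)
open import Data.List using (List; []; _∷_; _++_; map; foldr; upTo; applyUpTo)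
open import Data.List.Properties using (map-upTo)
open import Data.List.Relation.Unary.All using (All; []; _∷_)
open import Data.List.Relation.Unary.All.Properties using (++⁺; map⁺; applyUpTo⁺₁)
open import Data.List.Relation.Unary.Any using (here; there)
open import Data.List.Membership.Propositional using (_∈_)
open import Data.List.Membership.Propositional.Properties using (∈-++⁺ˡ; ∈-++⁺ʳ; ∈-map⁺; ∈-upTo⁺)
open import Data.Product using (∃-syntax; _×_; _,_; proj₁; proj₂)
open import Data.Sum using (_⊎_; inj₁; inj₂)
open import Data.Empty using (⊥-elim)
open import Relation.Nullary using (¬_; yes; no)
open import Relation.Binary.PropositionalEquality
open import Algebra.Properties.CommutativeSemigroup +-commutativeSemigroup using (interchange)

-- Finite sums

∑ : (ℕ → ℕ) → ℕ → ℕ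
∑ f zero = 0
∑ f (suc n) = f 0 + ∑ (λ i → f (suc i)) n

-- The body of ∑[ i < n ] extends over an application only: ∑[ i < n ] f i + c is (∑[ i < n ] f i) + c.
infixr 8 ∑
syntax ∑ (λ i → e) n = ∑[ i < n ] e

sum-applyUpTo : ∀ f n → sum (applyUpTo f n) ≡ ∑ f n
sum-applyUpTo f zero = refl
sum-applyUpTo f (suc n) = cong (f 0 +_) (sum-applyUpTo (λ i → f (suc i)) n)

sum-map-upTo : ∀ f n → sum (map f (upTo n)) ≡ ∑ f n
sum-map-upTo f n = trans (cong sum (map-upTo f n)) (sum-applyUpTo f n)

∑-cong : ∀ {f g} n → (∀ i → i < n → f i ≡ g i) → ∑ f n ≡ ∑ g n
∑-cong zero e = refl
∑-cong (suc n) e = cong₂ _+_ (e 0 z<s) (∑-cong n (λ i p → e (suc i) (s<s p)))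

∑-distrib-+ : ∀ f g n → ∑[ i < n ] (f i + g i) ≡ ∑ f n + ∑ g n
∑-distrib-+ f g zero = refl
∑-distrib-+ f g (suc n) =
  trans (cong (f 0 + g 0 +_) (∑-distrib-+ (λ i → f (suc i)) (λ i → g (suc i)) n))
        (interchange (f 0) (g 0) _ _)

∑-distribˡ-* : ∀ c f n → ∑[ i < n ] (c * f i) ≡ c * ∑ f n
∑-distribˡ-* c f zero = sym (*-zeroʳ c)
∑-distribˡ-* c f (suc n) =
  trans (cong (c * f 0 +_) (∑-distribˡ-* c (λ i → f (suc i)) n)) (sym (*-distribˡ-+ c (f 0) _))

∑-const : ∀ c n → ∑[ _ < n ] c ≡ n * c
∑-const c zero = refl
∑-const c (suc n) = cong (c +_) (∑-const c n)

∑-split : ∀ f k l → ∑ f (k + l) ≡ ∑ f k + ∑[ i < l ] f (k + i)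
∑-split f zero l = refl
∑-split f (suc k) l = trans (cong (f 0 +_) (∑-split (λ i → f (suc i)) k l)) (sym (+-assoc (f 0) _ _))

∑-snoc : ∀ f n → ∑ f (suc n) ≡ ∑ f n + f n
∑-snoc f n = begin
    ∑ f (suc n)             ≡⟨ cong (∑ f) (+-comm 1 n) ⟩
    ∑ f (n + 1)             ≡⟨ ∑-split f n 1 ⟩
    ∑ f n + (f (n + 0) + 0) ≡⟨ cong (∑ f n +_) (trans (+-identityʳ _) (cong f (+-identityʳ n))) ⟩
    ∑ f n + f n             ∎
  where open ≡-Reasoning

∑-comm : ∀ (f : ℕ → ℕ → ℕ) k l → ∑[ i < k ] ∑[ j < l ] f i j ≡ ∑[ j < l ] ∑[ i < k ] f i j
∑-comm f zero l = sym (trans (∑-const 0 l) (*-zeroʳ l))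
∑-comm f (suc k) l =
  trans (cong (∑ (f 0) l +_) (∑-comm (λ i → f (suc i)) k l))
        (sym (∑-distrib-+ (f 0) (λ j → ∑[ i < k ] f (suc i) j) l))

∑-reverse : ∀ f n → ∑ f n ≡ ∑[ i < n ] f (n ∸ suc i)
∑-reverse f zero = refl
∑-reverse f (suc n) = begin
    f 0 + ∑[ i < n ] f (suc i)
  ≡⟨ cong (f 0 +_) (∑-reverse (λ i → f (suc i)) n) ⟩
    f 0 + ∑[ i < n ] f (suc (n ∸ suc i))
  ≡⟨ +-comm (f 0) _ ⟩
    ∑[ i < n ] f (suc (n ∸ suc i)) + f 0
  ≡⟨ cong₂ _+_ (∑-cong n (λ i i<n → cong f (sym (+-∸-assoc 1 i<n)))) (cong f (sym (n∸n≡0 n))) ⟩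
    ∑[ i < n ] f (suc n ∸ suc i) + f (suc n ∸ suc n)
  ≡⟨ sym (∑-snoc (λ i → f (suc n ∸ suc i)) n) ⟩
    ∑[ i < suc n ] f (suc n ∸ suc i) ∎
  where open ≡-Reasoning

∑-+ʳ : ∀ (f : ℕ → ℕ) c k → ∑[ t < k ] (f t + c) ≡ ∑ f k + k * c
∑-+ʳ f c k = trans (∑-distrib-+ f (λ _ → c) k) (cong (∑ f k +_) (∑-const c k))

∑-+ˡ : ∀ (f : ℕ → ℕ) c k → ∑[ t < k ] (c + f t) ≡ k * c + ∑ f k
∑-+ˡ f c k = trans (∑-distrib-+ (λ _ → c) f k) (cong (_+ ∑ f k) (∑-const c k))

∑-distribʳ-* : ∀ f n c → ∑ f n * c ≡ ∑[ i < n ] (f i * c)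
∑-distribʳ-* f n c = trans (*-comm (∑ f n) c) (trans (sym (∑-distribˡ-* c f n)) (∑-cong n (λ i _ → *-comm c (f i))))

⟦_⟧ : Bool → ℕ
⟦ b ⟧ = if b then 1 else 0

∑-indicator : ∀ (g : ℕ → ℕ) c n → c < n → ∑[ i < n ] (⟦ i ≡ᵇ c ⟧ * g i) ≡ g c
∑-indicator g zero (suc n) _ = begin
    g 0 + 0 + ∑[ i < n ] (⟦ suc i ≡ᵇ 0 ⟧ * g (suc i))   ≡⟨ cong (g 0 + 0 +_) (trans (∑-const 0 n) (*-zeroʳ n)) ⟩
    g 0 + 0 + 0                                         ≡⟨ trans (+-identityʳ _) (+-identityʳ _) ⟩
    g 0                                                 ∎
  where open ≡-Reasoning
∑-indicator g (suc c) (suc n) (s≤s c<n) = ∑-indicator (λ i → g (suc i)) c n c<n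

countB-applyUpTo : ∀ (p : ℕ → Bool) f n → countB p (applyUpTo f n) ≡ ∑[ i < n ] ⟦ p (f i) ⟧
countB-applyUpTo p f zero = refl
countB-applyUpTo p f (suc n) = cong (⟦ p (f 0) ⟧ +_) (countB-applyUpTo p (λ i → f (suc i)) n)

any-applyUpTo⁻ : ∀ (p : ℕ → Bool) f n → any p (applyUpTo f n) ≡ true → ∃[ i ] (i < n × p (f i) ≡ true)
any-applyUpTo⁻ p f (suc n) e with p (f 0) in eq
... | true = 0 , z<s , eq
... | false with any-applyUpTo⁻ p (λ i → f (suc i)) n e
... | i , i<n , q = suc i , s<s i<n , q

any-applyUpTo⁺ : ∀ (p : ℕ → Bool) f n i → i < n → p (f i) ≡ true → any p (applyUpTo f n) ≡ true
any-applyUpTo⁺ p f (suc n) zero _ e rewrite e = refl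
any-applyUpTo⁺ p f (suc n) (suc i) (s≤s i<n) e with p (f 0)
... | true = refl
... | false = any-applyUpTo⁺ p (λ i → f (suc i)) n i i<n e

≡ᵇ-refl : ∀ c → (c ≡ᵇ c) ≡ true
≡ᵇ-refl zero = refl
≡ᵇ-refl (suc c) = ≡ᵇ-refl c

≡ᵇ-true⇒≡ : ∀ {x y} → (x ≡ᵇ y) ≡ true → x ≡ y
≡ᵇ-true⇒≡ {zero} {zero} e = refl
≡ᵇ-true⇒≡ {suc x} {suc y} e = cong suc (≡ᵇ-true⇒≡ e)

⟦∨⟧ : ∀ p q → (p ≡ true → q ≡ false) → ⟦ p ∨ q ⟧ ≡ ⟦ p ⟧ + ⟦ q ⟧
⟦∨⟧ true q excl rewrite excl refl = refl
⟦∨⟧ false q _ = refl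

⟦∧∨⟧ : ∀ c p q → (p ≡ true → q ≡ false) → ⟦ c ∧ (p ∨ q) ⟧ ≡ ⟦ p ⟧ * ⟦ c ⟧ + ⟦ q ⟧ * ⟦ c ⟧
⟦∧∨⟧ true p q excl = trans (⟦∨⟧ p q excl) (sym (cong₂ _+_ (*-identityʳ ⟦ p ⟧) (*-identityʳ ⟦ q ⟧)))
⟦∧∨⟧ false p q _ = sym (cong₂ _+_ (*-zeroʳ ⟦ p ⟧) (*-zeroʳ ⟦ q ⟧))

≡ᵇ-sym : ∀ x y → (x ≡ᵇ y) ≡ (y ≡ᵇ x)
≡ᵇ-sym zero zero = refl
≡ᵇ-sym zero (suc y) = refl
≡ᵇ-sym (suc x) zero = refl
≡ᵇ-sym (suc x) (suc y) = ≡ᵇ-sym x y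

⟦<ᵇ⟧+⟦>ᵇ⟧≡1 : ∀ x y → ¬ x ≡ y → ⟦ x <ᵇ y ⟧ + ⟦ y <ᵇ x ⟧ ≡ 1
⟦<ᵇ⟧+⟦>ᵇ⟧≡1 zero zero x≢y = ⊥-elim (x≢y refl)
⟦<ᵇ⟧+⟦>ᵇ⟧≡1 zero (suc y) _ = refl
⟦<ᵇ⟧+⟦>ᵇ⟧≡1 (suc x) zero _ = refl
⟦<ᵇ⟧+⟦>ᵇ⟧≡1 (suc x) (suc y) x≢y = ⟦<ᵇ⟧+⟦>ᵇ⟧≡1 x y (λ e → x≢y (cong suc e))

<ᵇ-true : ∀ {i k} → i < k → (i <ᵇ k) ≡ true
<ᵇ-true {zero} {suc k} _ = refl
<ᵇ-true {suc i} {suc k} (s≤s i<k) = <ᵇ-true i<k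

<ᵇ-false : ∀ {i k} → k ≤ i → (i <ᵇ k) ≡ false
<ᵇ-false {i} {zero} _ = refl
<ᵇ-false {suc i} {suc k} (s≤s k≤i) = <ᵇ-false k≤i

any-∈ : ∀ {A : Set} (p : A → Bool) {e : A} {l : List A} → e ∈ l → p e ≡ true → any p l ≡ true
any-∈ p (here refl) pe rewrite pe = refl
any-∈ p {l = x ∷ l} (there e∈l) pe with p x
... | true = refl
... | false = any-∈ p e∈l pe

any-All : ∀ {A : Set} (p : A → Bool) {P : A → Set} (l : List A) → any p l ≡ true → All P l → ∃[ e ] (P e × p e ≡ true)
any-All p (x ∷ l) e (px ∷ Pl) with p x in eq
... | true = x , px , eq
... | false = any-All p l e Pl

maximum : List ℕ → ℕ
maximum = foldr _⊔_ 0

maximum-applyUpTo-≤ : ∀ (f : ℕ → ℕ) n K → (∀ i → i < n → f i ≤ K) → maximum (applyUpTo f n) ≤ K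
maximum-applyUpTo-≤ f zero K e = z≤n
maximum-applyUpTo-≤ f (suc n) K e =
  ⊔-lub (e 0 z<s) (maximum-applyUpTo-≤ (λ i → f (suc i)) n K (λ i p → e (suc i) (s<s p)))

≤-maximum-applyUpTo : ∀ (f : ℕ → ℕ) n i → i < n → f i ≤ maximum (applyUpTo f n)
≤-maximum-applyUpTo f (suc n) zero _ = m≤m⊔n (f 0) _
≤-maximum-applyUpTo f (suc n) (suc i) (s≤s i<n) =
  ≤-trans (≤-maximum-applyUpTo (λ i → f (suc i)) n i i<n) (m≤n⊔m (f 0) _)

-- Distances from a vertex

module DistanceCharacterisation (G : Graph) (x : ℕ) (δ : ℕ → ℕ)
  (δ-source : δ x ≡ 0)
  (δ≡0⇒source : ∀ y → y < order G → δ y ≡ 0 → x ≡ y)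
  (δ-edge : ∀ z y → z < order G → y < order G → adj G z y ≡ true → δ y ≤ suc (δ z))
  (δ-descent : ∀ y → y < order G → 0 < δ y →
               ∃[ z ] (z < order G × adj G z y ≡ true × suc (δ z) ≡ δ y))
  where

  private
    N = order G

    ∧-true⁻ : ∀ {p q : Bool} → (p ∧ q) ≡ true → p ≡ true × q ≡ true
    ∧-true⁻ {true} e = refl , e

  within⇒δ≤ : ∀ k y → y < N → within G k x y ≡ true → δ y ≤ k
  within⇒δ≤ zero y _ e = ≤-reflexive (trans (cong δ (sym (≡ᵇ-true⇒≡ e))) δ-source)
  within⇒δ≤ (suc k) y y<N e with within G k x y in eq
  ... | true = m≤n⇒m≤1+n (within⇒δ≤ k y y<N eq)
  ... | false with any-applyUpTo⁻ (λ z → within G k x z ∧ adj G z y) (λ i → i) N e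
  ... | z , z<N , ez with ∧-true⁻ ez
  ... | wz , azy = ≤-trans (δ-edge z y z<N y<N azy) (s≤s (within⇒δ≤ k z z<N wz))

  δ≤⇒within : ∀ k y → y < N → δ y ≤ k → within G k x y ≡ true
  δ≤⇒within zero y y<N le rewrite δ≡0⇒source y y<N (n≤0⇒n≡0 le) = ≡ᵇ-refl y
  δ≤⇒within (suc k) y y<N le with ≤-<-connex (δ y) k
  ... | inj₁ le′ rewrite δ≤⇒within k y y<N le′ = refl
  ... | inj₂ gt with δ-descent y y<N (≤-<-trans z≤n gt)
  ... | z , z<N , azy , ez with within G k x y
  ...   | true = refl
  ...   | false = any-applyUpTo⁺ (λ z → within G k x z ∧ adj G z y) (λ i → i) N z z<N
                    (cong₂ _∧_ (δ≤⇒within k z z<N (≤-pred (≤-trans (≤-reflexive ez) le))) azy)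

  searchDist≡δ : ∀ fuel k y → y < N → k ≤ δ y → δ y < k + fuel → searchDist G k fuel x y ≡ δ y
  searchDist≡δ zero k y _ k≤δ δ<k = ⊥-elim (<-irrefl refl (≤-<-trans k≤δ (subst (δ y <_) (+-identityʳ k) δ<k)))
  searchDist≡δ (suc fuel) k y y<N k≤δ δ<k with within G k x y in eq
  ... | true = ≤-antisym k≤δ (within⇒δ≤ k y y<N eq)
  ... | false with m≤n⇒m<n∨m≡n k≤δ
  ...   | inj₁ k<δ = searchDist≡δ fuel (suc k) y y<N k<δ (subst (δ y <_) (+-suc k fuel) δ<k)
  ...   | inj₂ refl with () ← trans (sym (δ≤⇒within k y y<N ≤-refl)) eq

  dist≡δ : ∀ y → y < N → δ y < N → dist G x y ≡ δ y
  dist≡δ y y<N δ<N = searchDist≡δ N 0 y y<N z≤n δ<N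

-- Triangular numbers and sums of distances along a path

Δ : ℕ → ℕ
Δ k = ∑[ i < k ] i

Δ⁺ : ℕ → ℕ
Δ⁺ k = ∑[ i < k ] suc i

Δ⁺≡Δ+ : ∀ k → Δ⁺ k ≡ Δ k + k
Δ⁺≡Δ+ k = trans (∑-cong k (λ t _ → +-comm 1 t)) (trans (∑-+ʳ (λ i → i) 1 k) (cong (Δ k +_) (*-identityʳ k)))

2Δ+k≡k² : ∀ k → 2 * Δ k + k ≡ k * k
2Δ+k≡k² zero = refl
2Δ+k≡k² (suc k) = begin
    2 * Δ (suc k) + suc k        ≡⟨ cong (λ z → 2 * z + suc k) (∑-snoc (λ i → i) k) ⟩
    2 * (Δ k + k) + suc k        ≡⟨ regroup (Δ k) k ⟩
    (2 * Δ k + k) + 2 * k + 1    ≡⟨ cong (λ z → z + 2 * k + 1) (2Δ+k≡k² k) ⟩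
    k * k + 2 * k + 1            ≡⟨ square-suc k ⟩
    suc k * suc k                ∎
  where
  open ≡-Reasoning
  regroup : ∀ t k → 2 * (t + k) + suc k ≡ (2 * t + k) + 2 * k + 1
  regroup = solve-∀
  square-suc : ∀ k → k * k + 2 * k + 1 ≡ suc k * suc k
  square-suc = solve-∀

absDiffSum : ℕ → ℕ
absDiffSum k = ∑[ i < k ] ∑[ t < k ] ∣ i - t ∣

absDiffSum⁺ : ℕ → ℕ
absDiffSum⁺ k = ∑[ i < k ] ∑[ t < k ] ∣ i - suc t ∣

absDiffSum-suc : ∀ k → absDiffSum (suc k) ≡ Δ⁺ k + Δ⁺ k + absDiffSum k
absDiffSum-suc k =
  trans (cong (Δ⁺ k +_) (∑-distrib-+ suc (λ i → ∑[ t < k ] ∣ i - t ∣) k))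
        (sym (+-assoc (Δ⁺ k) (Δ⁺ k) (absDiffSum k)))

3absDiffSum+k≡k³ : ∀ k → 3 * absDiffSum k + k ≡ k * k * k
3absDiffSum+k≡k³ zero = refl
3absDiffSum+k≡k³ (suc k) = begin
    3 * absDiffSum (suc k) + suc k
  ≡⟨ cong (λ z → 3 * z + suc k) (absDiffSum-suc k) ⟩
    3 * (Δ⁺ k + Δ⁺ k + absDiffSum k) + suc k
  ≡⟨ cong (λ z → 3 * (z + z + absDiffSum k) + suc k) (Δ⁺≡Δ+ k) ⟩
    3 * (Δ k + k + (Δ k + k) + absDiffSum k) + suc k
  ≡⟨ regroup (Δ k) k (absDiffSum k) ⟩
    3 * (2 * Δ k + k) + (3 * absDiffSum k + k) + 3 * k + 1
  ≡⟨ cong₂ (λ x y → 3 * x + y + 3 * k + 1) (2Δ+k≡k² k) (3absDiffSum+k≡k³ k) ⟩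
    3 * (k * k) + k * k * k + 3 * k + 1
  ≡⟨ cube-suc k ⟩
    suc k * suc k * suc k ∎
  where
  open ≡-Reasoning
  regroup : ∀ t k f → 3 * (t + k + (t + k) + f) + suc k ≡ 3 * (2 * t + k) + (3 * f + k) + 3 * k + 1
  regroup = solve-∀
  cube-suc : ∀ k → 3 * (k * k) + k * k * k + 3 * k + 1 ≡ suc k * suc k * suc k
  cube-suc = solve-∀

absDiffSum⁺≡ : ∀ k → absDiffSum⁺ k ≡ absDiffSum k + k
absDiffSum⁺≡ k = +-cancelʳ-≡ (Δ k) _ _ (begin
    absDiffSum⁺ k + Δ k
  ≡⟨ sym (∑-distrib-+ (λ i → ∑[ t < k ] ∣ i - suc t ∣) (λ i → i) k) ⟩
    ∑[ i < k ] (∑[ t < k ] ∣ i - suc t ∣ + i)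
  ≡⟨ ∑-cong k (λ i _ → shift i) ⟩
    ∑[ i < k ] (∑[ t < k ] ∣ i - t ∣ + ∣ i - k ∣)
  ≡⟨ ∑-distrib-+ _ _ k ⟩
    absDiffSum k + ∑[ i < k ] ∣ i - k ∣
  ≡⟨ cong (absDiffSum k +_) (∑∣i-k∣ k) ⟩
    absDiffSum k + Δ⁺ k
  ≡⟨ cong (absDiffSum k +_) (Δ⁺≡Δ+ k) ⟩
    absDiffSum k + (Δ k + k)
  ≡⟨ regroup (absDiffSum k) (Δ k) k ⟩
    absDiffSum k + k + Δ k ∎)
  where
  open ≡-Reasoning
  shift : ∀ i → ∑[ t < k ] ∣ i - suc t ∣ + i ≡ ∑[ t < k ] ∣ i - t ∣ + ∣ i - k ∣
  shift i = trans (cong (∑[ t < k ] ∣ i - suc t ∣ +_) (sym (∣-∣-identityʳ i)))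
                  (trans (+-comm _ ∣ i - 0 ∣) (∑-snoc (λ t → ∣ i - t ∣) k))
  ∑∣i-k∣ : ∀ k → ∑[ i < k ] ∣ i - k ∣ ≡ Δ⁺ k
  ∑∣i-k∣ zero = refl
  ∑∣i-k∣ (suc k) = trans (cong (suc k +_) (∑∣i-k∣ k)) (trans (+-comm (suc k) (Δ⁺ k)) (sym (∑-snoc suc k)))
  regroup : ∀ f t k → f + (t + k) ≡ f + k + t
  regroup = solve-∀

2Δ⁺≡k²+k : ∀ k → 2 * Δ⁺ k ≡ k * k + k
2Δ⁺≡k²+k k = begin
    2 * Δ⁺ k          ≡⟨ cong (2 *_) (Δ⁺≡Δ+ k) ⟩
    2 * (Δ k + k)     ≡⟨ regroup (Δ k) k ⟩
    2 * Δ k + k + k   ≡⟨ cong (_+ k) (2Δ+k≡k² k) ⟩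
    k * k + k         ∎
  where
  open ≡-Reasoning
  regroup : ∀ t k → 2 * (t + k) ≡ 2 * t + k + k
  regroup = solve-∀

∑-affine : ∀ (f g : ℕ → ℕ) c d k → ∑[ i < k ] (c + d * i + (f i + g i)) ≡ k * c + d * Δ k + (∑ f k + ∑ g k)
∑-affine f g c d k = trans (∑-distrib-+ (λ i → c + d * i) (λ i → f i + g i) k)
  (cong₂ _+_ (trans (∑-+ˡ (d *_) c k) (cong (k * c +_) (∑-distribˡ-* d (λ i → i) k))) (∑-distrib-+ f g k))

-- The cycle

+≡⇒∸≡ : ∀ {a k e} → k + e ≡ a → a ∸ k ≡ e
+≡⇒∸≡ {k = k} {e} refl = m+n∸m≡n k e

∣m+n-m∣≡n : ∀ m n → ∣ m + n - m ∣ ≡ n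
∣m+n-m∣≡n m n = trans (∣-∣-comm (m + n) m) (∣m-m+n∣≡n m n)

data Compare (i j : ℕ) : Set where
  equal   : i ≡ j → Compare i j
  less    : ∀ k → j ≡ i + suc k → Compare i j
  greater : ∀ k → i ≡ j + suc k → Compare i j

compare′ : ∀ i j → Compare i j
compare′ zero zero = equal refl
compare′ zero (suc j) = less j refl
compare′ (suc i) zero = greater i refl
compare′ (suc i) (suc j) with compare′ i j
... | equal e = equal (cong suc e)
... | less k e = less k (cong suc e)
... | greater k e = greater k (cong suc e)

Near : ℕ → ℕ → Set
Near x y = x ≤ suc y × y ≤ suc x

Near-sym : ∀ {x y} → Near x y → Near y x
Near-sym (p , q) = q , p

Near-suc : ∀ {x y} → x ≡ suc y → Near x y
Near-suc {y = y} refl = ≤-refl , ≤-trans (n≤1+n y) (n≤1+n _)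

Near-+ˡ : ∀ c {x y} → Near x y → Near (c + x) (c + y)
Near-+ˡ c {x} {y} (p , q) = subst (c + x ≤_) (+-suc c y) (+-monoʳ-≤ c p) , subst (c + y ≤_) (+-suc c x) (+-monoʳ-≤ c q)

∣-∣-step : ∀ i j → (∣ i - suc j ∣ ≡ suc ∣ i - j ∣) ⊎ (∣ i - j ∣ ≡ suc ∣ i - suc j ∣)
∣-∣-step zero j = inj₁ refl
∣-∣-step (suc i) zero = inj₂ (cong suc (sym (∣-∣-identityʳ i)))
∣-∣-step (suc i) (suc j) = ∣-∣-step i j

module Cycle (m : ℕ) where

  cycleDist : ℕ → ℕ
  cycleDist k = k ⊓ (m ∸ k)

  cdist : ℕ → ℕ → ℕ
  cdist i j = cycleDist ∣ i - j ∣

  prev : ℕ → ℕ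
  prev zero = m ∸ 1
  prev (suc j) = j

  private
    m∸k≡suc : ∀ {k} → k < m → m ∸ k ≡ suc (m ∸ suc k)
    m∸k≡suc k<m = +-∸-assoc 1 k<m

  cycleDist-suc≤ : ∀ k → k < m → cycleDist (suc k) ≤ suc (cycleDist k)
  cycleDist-suc≤ k k<m rewrite m∸k≡suc k<m = ⊓-mono-≤ (≤-refl {suc k}) (≤-trans (n≤1+n _) (n≤1+n _))

  cycleDist≤suc : ∀ k → k < m → cycleDist k ≤ suc (cycleDist (suc k))
  cycleDist≤suc k k<m rewrite m∸k≡suc k<m = ⊓-mono-≤ (≤-trans (n≤1+n k) (n≤1+n _)) (≤-refl {suc (m ∸ suc k)})

  cycleDist-reflect : ∀ k → k ≤ m → cycleDist (m ∸ k) ≡ cycleDist k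
  cycleDist-reflect k k≤m rewrite m∸[m∸n]≡n k≤m = ⊓-comm (m ∸ k) k

  cycleDist-pos : ∀ k → 0 < k → k < m → 0 < cycleDist k
  cycleDist-pos (suc k) _ k<m rewrite m∸k≡suc k<m = z<s

  cycleDist-descent : ∀ k → 0 < k → k < m →
    (suc (cycleDist (pred k)) ≡ cycleDist k) ⊎ (suc (cycleDist (suc k)) ≡ cycleDist k)
  cycleDist-descent (suc k) _ k<m with ≤-total (suc k) (m ∸ suc k)
  ... | inj₁ le = inj₁ (trans (cong suc (m≤n⇒m⊓n≡m (≤-trans (n≤1+n k) (≤-trans le (∸-monoʳ-≤ m (n≤1+n k))))))
                              (sym (m≤n⇒m⊓n≡m le)))
  ... | inj₂ ge = inj₂ (trans (cong suc (m≥n⇒m⊓n≡n (≤-trans (∸-monoʳ-≤ m (n≤1+n (suc k))) (≤-trans ge (n≤1+n _)))))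
                              (sym (trans (m≥n⇒m⊓n≡n ge) (m∸k≡suc k<m))))

  cdist-self : ∀ i → cdist i i ≡ 0
  cdist-self i = cong cycleDist (∣n-n∣≡0 i)

  cdist-sym : ∀ i j → cdist i j ≡ cdist j i
  cdist-sym i j = cong cycleDist (∣-∣-comm i j)

  cdist≡0⇒≡ : ∀ i j → i < m → j < m → cdist i j ≡ 0 → i ≡ j
  cdist≡0⇒≡ i j i<m j<m e with compare′ i j
  ... | equal i≡j = i≡j
  ... | less k refl = ⊥-elim (<-irrefl (sym e) (subst (λ z → 0 < cycleDist z) (sym (∣m-m+n∣≡n i (suc k)))
                        (cycleDist-pos (suc k) z<s (≤-trans (s≤s (m≤n+m (suc k) i)) j<m))))
  ... | greater k refl = ⊥-elim (<-irrefl (sym e) (subst (λ z → 0 < cycleDist z) (sym (∣m+n-m∣≡n j (suc k)))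
                        (cycleDist-pos (suc k) z<s (≤-trans (s≤s (m≤n+m (suc k) j)) i<m))))

  ∣-∣< : ∀ i j → i < m → j < m → ∣ i - j ∣ < m
  ∣-∣< i j i<m j<m = ≤-<-trans (∣m-n∣≤m⊔n i j) (⊔-lub i<m j<m)

  cdist-near-suc : ∀ i j → i < m → suc j < m → Near (cdist i j) (cdist i (suc j))
  cdist-near-suc i j i<m sj<m with ∣-∣-step i j
  ... | inj₁ e = subst (λ z → Near (cycleDist ∣ i - j ∣) (cycleDist z)) (sym e) (cycleDist≤suc _ lt , cycleDist-suc≤ _ lt)
    where
    lt : ∣ i - j ∣ < m
    lt = ≤-trans (n≤1+n _) (subst (_< m) e (∣-∣< i (suc j) i<m sj<m))
  ... | inj₂ e = subst (λ z → Near (cycleDist z) (cycleDist ∣ i - suc j ∣)) (sym e) (cycleDist-suc≤ _ lt , cycleDist≤suc _ lt)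
    where
    lt : ∣ i - suc j ∣ < m
    lt = ≤-trans (n≤1+n _) (subst (_< m) e (∣-∣< i j i<m (≤-trans (n≤1+n _) sj<m)))

  cdist-last : ∀ i → i < m → cdist i (m ∸ 1) ≡ cycleDist (suc i)
  cdist-last i i<m = trans (cong cycleDist ∣i-[m∸1]∣) (cycleDist-reflect (suc i) i<m)
    where
    ∣i-[m∸1]∣ : ∣ i - (m ∸ 1) ∣ ≡ m ∸ suc i
    ∣i-[m∸1]∣ = trans (cong (λ z → ∣ i - z ∣) (sym (cong (_∸ 1) (m+[n∸m]≡n i<m)))) (∣m-m+n∣≡n i (m ∸ suc i))

  cdist-near-wrap : ∀ i → i < m → Near (cdist i (m ∸ 1)) (cdist i 0)
  cdist-near-wrap i i<m = subst₂ Near (sym (cdist-last i i<m)) (cong cycleDist (sym (∣-∣-identityʳ i)))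
                            (cycleDist-suc≤ i i<m , cycleDist≤suc i i<m)

  cdist-near-prev : ∀ i j → i < m → j < m → Near (cdist i j) (cdist i (prev j))
  cdist-near-prev i zero i<m _ = Near-sym (cdist-near-wrap i i<m)
  cdist-near-prev i (suc j) i<m j<m = Near-sym (cdist-near-suc i j i<m j<m)

  CycleAdj : ℕ → ℕ → Set
  CycleAdj j′ j = (prev j ≡ j′) ⊎ (prev j′ ≡ j)

  private
    prev-suc : ∀ {x y} → x ≡ suc y → prev x ≡ y
    prev-suc refl = refl

  cdist-descent : ∀ i j → i < m → j < m → ¬ i ≡ j →
    ∃[ j′ ] (j′ < m × CycleAdj j′ j × suc (cdist i j′) ≡ cdist i j)
  cdist-descent i j i<m j<m i≢j with compare′ i j
  ... | equal i≡j = ⊥-elim (i≢j i≡j)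
  ... | less k refl with cycleDist-descent (suc k) z<s (≤-<-trans (m≤n+m (suc k) i) j<m)
  ... | inj₁ e = i + k , ≤-trans (≤-reflexive (sym (+-suc i k))) (<⇒≤ j<m) , inj₁ (prev-suc (+-suc i k)) ,
                 trans (cong (λ z → suc (cycleDist z)) (∣m-m+n∣≡n i k)) (trans e (cong cycleDist (sym (∣m-m+n∣≡n i (suc k)))))
  ... | inj₂ e with suc (i + suc k) <? m
  ...   | yes sj<m = suc (i + suc k) , sj<m , inj₂ refl ,
                     trans (cong (λ z → suc (cycleDist ∣ i - z ∣)) (sym (+-suc i (suc k))))
                       (trans (cong (λ z → suc (cycleDist z)) (∣m-m+n∣≡n i (suc (suc k))))
                         (trans e (cong cycleDist (sym (∣m-m+n∣≡n i (suc k))))))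
  ...   | no sj≮m = 0 , ≤-trans z<s j<m , inj₂ (cong (_∸ 1) m≡sj) ,
                    trans (cong (λ z → suc (cycleDist z)) (∣-∣-identityʳ i))
                      (trans (cong suc (sym (cycleDist-reflect i (≤-trans (m≤m+n i (suc k)) (<⇒≤ j<m)))))
                        (trans (cong (λ z → suc (cycleDist z)) (+≡⇒∸≡ (trans (+-suc i (suc k)) (sym m≡sj))))
                          (trans e (cong cycleDist (sym (∣m-m+n∣≡n i (suc k)))))))
    where
    m≡sj : m ≡ suc (i + suc k)
    m≡sj = ≤-antisym (≮⇒≥ sj≮m) j<m
  cdist-descent i j i<m j<m i≢j | greater k refl with cycleDist-descent (suc k) z<s (≤-<-trans (m≤n+m (suc k) j) i<m)
  ... | inj₁ e = suc j , ≤-<-trans (≤-trans (s≤s (m≤m+n j k)) (≤-reflexive (sym (+-suc j k)))) i<m , inj₂ refl ,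
                 trans (cong (λ z → suc (cycleDist ∣ z - suc j ∣)) (+-suc j k))
                   (trans (cong (λ z → suc (cycleDist z)) (∣m+n-m∣≡n (suc j) k)) (trans e (cong cycleDist (sym (∣m+n-m∣≡n j (suc k))))))
  cdist-descent i zero i<m j<m i≢j | greater k refl | inj₂ e =
    m ∸ 1 , ∸-monoʳ-< {m} {1} {0} z<s j<m , inj₁ refl ,
    trans (cong suc (cdist-last (suc k) i<m)) (trans e (cong cycleDist (sym (∣m+n-m∣≡n 0 (suc k)))))
  cdist-descent i (suc j) i<m j<m i≢j | greater k refl | inj₂ e =
    j , ≤-trans (n≤1+n _) j<m , inj₁ refl ,
    trans (cong (λ z → suc (cycleDist ∣ z - j ∣)) (sym (+-suc j (suc k))))
      (trans (cong (λ z → suc (cycleDist z)) (∣m+n-m∣≡n j (suc (suc k))))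
        (trans e (cong cycleDist (sym (∣m+n-m∣≡n (suc j) (suc k))))))

  cycleSum : ℕ
  cycleSum = ∑ cycleDist m

  ∑cdist≡cycleSum : ∀ i → i < m → ∑[ j < m ] cdist i j ≡ cycleSum
  ∑cdist≡cycleSum i i<m = begin
      ∑[ j < m ] cdist i j
    ≡⟨ cong (∑ (cdist i)) (sym i+L≡m) ⟩
      ∑[ j < i + L ] cdist i j
    ≡⟨ ∑-split (cdist i) i L ⟩
      ∑[ j < i ] cdist i j + ∑[ t < L ] cdist i (i + t)
    ≡⟨ cong₂ _+_ before-i (∑-cong L (λ t _ → cong cycleDist (∣m-m+n∣≡n i t))) ⟩
      ∑[ u < i ] cycleDist (L + u) + ∑ cycleDist L
    ≡⟨ +-comm _ (∑ cycleDist L) ⟩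
      ∑ cycleDist L + ∑[ u < i ] cycleDist (L + u)
    ≡⟨ sym (∑-split cycleDist L i) ⟩
      ∑ cycleDist (L + i)
    ≡⟨ cong (∑ cycleDist) (trans (+-comm L i) i+L≡m) ⟩
      cycleSum ∎
    where
    open ≡-Reasoning
    L = m ∸ i
    i+L≡m : i + L ≡ m
    i+L≡m = m+[n∸m]≡n (<⇒≤ i<m)
    before-i : ∑[ j < i ] cdist i j ≡ ∑[ u < i ] cycleDist (L + u)
    before-i = begin
        ∑[ j < i ] cdist i j
      ≡⟨ ∑-reverse (cdist i) i ⟩
        ∑[ t < i ] cdist i (i ∸ suc t)
      ≡⟨ ∑-cong i (λ t t<i → trans (cong cycleDist (trans (cong (λ z → ∣ z - i ∸ suc t ∣) (sym (m∸n+n≡m t<i)))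
                                                             (∣m+n-m∣≡n (i ∸ suc t) (suc t))))
                                    (sym (cycleDist-reflect (suc t) (≤-trans t<i (<⇒≤ i<m))))) ⟩
        ∑[ t < i ] cycleDist (m ∸ suc t)
      ≡⟨ ∑-reverse (λ t → cycleDist (m ∸ suc t)) i ⟩
        ∑[ u < i ] cycleDist (m ∸ suc (i ∸ suc u))
      ≡⟨ ∑-cong i (λ u u<i → cong cycleDist (trans (cong (m ∸_) (sym (+-∸-assoc 1 u<i))) (+≡⇒∸≡ {m} {i ∸ u} {L + u} (split u u<i)))) ⟩
        ∑[ u < i ] cycleDist (L + u) ∎
      where
      split : ∀ u → u < i → (i ∸ u) + (L + u) ≡ m
      split u u<i = trans (cong ((i ∸ u) +_) (+-comm L u))
                      (trans (sym (+-assoc (i ∸ u) u L)) (trans (cong (_+ L) (m∸n+n≡m (<⇒≤ u<i))) i+L≡m))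

  cycleSum-split : ∀ h L → m ≡ suc h + L → L ≤ h → h ≤ suc L → cycleSum ≡ Δ⁺ h + Δ⁺ L
  cycleSum-split h L m≡ L≤h h≤L+1 = begin
      ∑ cycleDist m
    ≡⟨ cong (∑ cycleDist) m≡ ⟩
      ∑ cycleDist (suc h + L)
    ≡⟨ ∑-split cycleDist (suc h) L ⟩
      ∑ cycleDist (suc h) + ∑[ t < L ] cycleDist (suc h + t)
    ≡⟨ cong₂ _+_ (∑-cong (suc h) (λ k k≤h → m≤n⇒m⊓n≡m (near k k≤h))) (∑-cong L far) ⟩
      Δ (suc h) + ∑[ t < L ] (L ∸ t)
    ≡⟨ cong (Δ⁺ h +_) (trans (∑-reverse (L ∸_) L) (∑-cong L (λ i i<L → m∸[m∸n]≡n i<L))) ⟩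
      Δ⁺ h + Δ⁺ L ∎
    where
    open ≡-Reasoning
    near : ∀ k → k < suc h → k ≤ m ∸ k
    near k k≤h = ≤-trans (≤-reflexive (sym (m+n∸n≡m k k))) (∸-monoˡ-≤ k k+k≤m)
      where
      k+k≤m : k + k ≤ m
      k+k≤m = ≤-trans (+-mono-≤ (≤-pred k≤h) (≤-pred k≤h))
                (≤-trans (+-monoʳ-≤ h h≤L+1) (≤-reflexive (trans (+-suc h L) (sym m≡))))
    far : ∀ t → t < L → cycleDist (suc h + t) ≡ L ∸ t
    far t t<L = trans (cong ((suc h + t) ⊓_) m∸[h+1+t]≡L∸t)
                  (m≥n⇒m⊓n≡n (≤-trans (m∸n≤m L t) (≤-trans L≤h (≤-trans (n≤1+n h) (m≤m+n (suc h) t)))))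
      where
      m∸[h+1+t]≡L∸t : m ∸ (suc h + t) ≡ L ∸ t
      m∸[h+1+t]≡L∸t = trans (sym (∸-+-assoc m (suc h) t)) (cong (_∸ t) (+≡⇒∸≡ (sym m≡)))

cycleSum≡ : ∀ h r → 1 ≤ h → r ≤ 1 → Cycle.cycleSum (h + h + r) ≡ h * h + r * h
cycleSum≡ (suc g) zero _ _ = *-cancelˡ-≡ _ _ 2 (begin
    2 * Cycle.cycleSum (suc g + suc g + 0)
  ≡⟨ cong (2 *_) (Cycle.cycleSum-split _ (suc g) g (m≡ g) (n≤1+n g) ≤-refl) ⟩
    2 * (Δ⁺ (suc g) + Δ⁺ g)
  ≡⟨ *-distribˡ-+ 2 (Δ⁺ (suc g)) (Δ⁺ g) ⟩
    2 * Δ⁺ (suc g) + 2 * Δ⁺ g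
  ≡⟨ cong₂ _+_ (2Δ⁺≡k²+k (suc g)) (2Δ⁺≡k²+k g) ⟩
    (suc g * suc g + suc g) + (g * g + g)
  ≡⟨ regroup g ⟩
    2 * (suc g * suc g + 0 * suc g) ∎)
  where
  open ≡-Reasoning
  m≡ : ∀ g → suc g + suc g + 0 ≡ suc (suc g) + g
  m≡ = solve-∀
  regroup : ∀ g → (suc g * suc g + suc g) + (g * g + g) ≡ 2 * (suc g * suc g + 0 * suc g)
  regroup = solve-∀
cycleSum≡ h (suc zero) _ _ = *-cancelˡ-≡ _ _ 2 (begin
    2 * Cycle.cycleSum (h + h + 1)
  ≡⟨ cong (2 *_) (Cycle.cycleSum-split _ h h (m≡ h) ≤-refl (n≤1+n h)) ⟩
    2 * (Δ⁺ h + Δ⁺ h)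
  ≡⟨ *-distribˡ-+ 2 (Δ⁺ h) (Δ⁺ h) ⟩
    2 * Δ⁺ h + 2 * Δ⁺ h
  ≡⟨ cong (λ z → z + z) (2Δ⁺≡k²+k h) ⟩
    (h * h + h) + (h * h + h)
  ≡⟨ regroup h ⟩
    2 * (h * h + 1 * h) ∎)
  where
  open ≡-Reasoning
  m≡ : ∀ h → h + h + 1 ≡ suc h + h
  m≡ = solve-∀
  regroup : ∀ h → (h * h + h) + (h * h + h) ≡ 2 * (h * h + 1 * h)
  regroup = solve-∀
cycleSum≡ h (suc (suc r)) _ (s≤s ())

-- The polynomial identities

-- Written over an arbitrary signature so that each formula can be read both as a natural number
-- and as a ring-solver expression, which lets `solve` see through the definitions.
module Formulas {A : Set} (plus times : A → A → A) (#_ : ℕ → A) where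

  -- The arguments stand for W = cycleSum, Ta = Δ a, Tpa = Δ⁺ a, Fa = absDiffSum a, F⁺a = absDiffSum⁺ a
  -- (likewise for b) and S = Σ_j pendantSum j.
  infixl 6 _⊕_
  infixl 7 _⊗_
  _⊕_ _⊗_ : A → A → A
  _⊕_ = plus
  _⊗_ = times

  cycleTotal : (m W a b q Tpa Tpb : A) → A
  cycleTotal m W a b q Tpa Tpb = m ⊗ (W ⊕ Tpa ⊕ Tpb ⊕ q) ⊕ ((a ⊕ q) ⊗ W ⊕ b ⊗ W)

  pathAPart : (m W h a b q Ta Tpb Fa F⁺a : A) → A
  pathAPart m W h a b q Ta Tpb Fa F⁺a =
    a ⊗ (m ⊕ # 2 ⊗ W ⊕ # 2 ⊗ Tpb ⊕ b ⊕ # 2 ⊗ b ⊗ h ⊕ # 3 ⊗ q) ⊕ (# 2 ⊗ m ⊕ # 2 ⊗ b ⊕ # 2 ⊗ q) ⊗ Ta ⊕ (Fa ⊕ F⁺a)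

  pathBPart : (m W h a b q Tpa Tb Fb F⁺b : A) → A
  pathBPart m W h a b q Tpa Tb Fb F⁺b =
    b ⊗ (m ⊕ # 2 ⊗ W ⊕ # 2 ⊗ Tpa ⊕ a ⊕ # 2 ⊗ a ⊗ h ⊕ # 3 ⊗ q ⊕ # 2 ⊗ q ⊗ h) ⊕ (# 2 ⊗ m ⊕ # 2 ⊗ a ⊕ # 2 ⊗ q) ⊗ Tb ⊕ (Fb ⊕ F⁺b)

  pendantPart : (m W h a b q Tpa Tpb S : A) → A
  pendantPart m W h a b q Tpa Tpb S = q ⊗ (m ⊕ # 2 ⊗ W ⊕ # 2 ⊗ Tpa ⊕ a ⊕ # 2 ⊗ Tpb ⊕ b ⊕ # 2 ⊗ b ⊗ h ⊕ q) ⊕ S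

  degreeDistanceFormula : (m W h a b q Ta Tpa Fa F⁺a Tb Tpb Fb F⁺b S : A) → A
  degreeDistanceFormula m W h a b q Ta Tpa Fa F⁺a Tb Tpb Fb F⁺b S =
    cycleTotal m W a b q Tpa Tpb ⊕ cycleTotal m W a b q Tpa Tpb
    ⊕ pathAPart m W h a b q Ta Tpb Fa F⁺a ⊕ pathBPart m W h a b q Tpa Tb Fb F⁺b ⊕ pendantPart m W h a b q Tpa Tpb S

  closedForm : (m W h a b q a² a³ b² b³ 2q² : A) → A
  closedForm m W h a b q a² a³ b² b³ 2q² =
    # 3 ⊗ (# 4 ⊗ W ⊗ a ⊕ # 4 ⊗ W ⊗ b ⊕ # 2 ⊗ W ⊗ m ⊕ # 4 ⊗ W ⊗ q ⊕ # 2 ⊗ a ⊗ b ⊕ # 4 ⊗ a ⊗ b ⊗ h ⊕ a ⊗ m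
           ⊕ # 4 ⊗ a ⊗ q ⊕ # 4 ⊗ b ⊗ h ⊗ q ⊕ b ⊗ m ⊕ # 4 ⊗ b ⊗ q ⊕ # 3 ⊗ m ⊗ q ⊕ q ⊗ q)
    ⊕ # 3 ⊗ (# 2 ⊗ m ⊕ # 2 ⊗ b ⊕ # 2 ⊗ q) ⊗ a² ⊕ # 3 ⊗ (# 2 ⊗ m ⊕ # 2 ⊗ a ⊕ # 2 ⊗ q) ⊗ b²
    ⊕ (# 2 ⊗ a³ ⊕ a) ⊕ (# 2 ⊗ b³ ⊕ b) ⊕ # 3 ⊗ 2q²

  ddPoly : (h r a b q : A) → A
  ddPoly h r a b q = closedForm (h ⊕ h ⊕ r) (h ⊗ h ⊕ r ⊗ h) h a b q (a ⊗ a) (a ⊗ a ⊗ a) (b ⊗ b) (b ⊗ b ⊗ b) (# 2 ⊗ q ⊗ q)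

  gapPoly : (k r a b q : A) → A
  gapPoly k r a b q =
    # 59 ⊕ # 48 ⊗ q ⊕ # 6 ⊗ q ⊗ q ⊕ # 18 ⊗ b ⊕ # 12 ⊗ b ⊗ q ⊕ # 6 ⊗ b ⊗ b ⊕ # 18 ⊗ a ⊕ # 6 ⊗ a ⊗ a ⊕ # 54 ⊗ r
    ⊕ # 24 ⊗ r ⊗ q ⊕ # 12 ⊗ r ⊗ b ⊕ # 12 ⊗ r ⊗ a ⊕ # 12 ⊗ r ⊗ r ⊕ # 96 ⊗ k ⊕ # 36 ⊗ k ⊗ q ⊕ # 12 ⊗ k ⊗ b
    ⊕ # 12 ⊗ k ⊗ a ⊕ # 36 ⊗ k ⊗ r ⊕ # 36 ⊗ k ⊗ k

open Formulas _+_ _*_ (λ k → k) public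

private
  module Expr {n} = Formulas {A = Polynomial n} _:+_ _:*_ con

  closedForm-ring : ∀ m W h a b q Ta Fa Tb Fb S →
    3 * degreeDistanceFormula m W h a b q Ta (Ta + a) Fa (Fa + a) Tb (Tb + b) Fb (Fb + b) S + 6 * q
    ≡ closedForm m W h a b q (2 * Ta + a) (3 * Fa + a) (2 * Tb + b) (3 * Fb + b) (S + 2 * q)
  closedForm-ring = solve 11 (λ m W h a b q Ta Fa Tb Fb S →
      con 3 :* Expr.degreeDistanceFormula m W h a b q Ta (Ta :+ a) Fa (Fa :+ a) Tb (Tb :+ b) Fb (Fb :+ b) S :+ con 6 :* q
    := Expr.closedForm m W h a b q (con 2 :* Ta :+ a) (con 3 :* Fa :+ a) (con 2 :* Tb :+ b) (con 3 :* Fb :+ b) (S :+ con 2 :* q)) refl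

closedForm-identity : ∀ {m W h a b q Ta Tpa Fa F⁺a Tb Tpb Fb F⁺b S} →
  Tpa ≡ Ta + a → F⁺a ≡ Fa + a → Tpb ≡ Tb + b → F⁺b ≡ Fb + b →
  3 * degreeDistanceFormula m W h a b q Ta Tpa Fa F⁺a Tb Tpb Fb F⁺b S + 6 * q
  ≡ closedForm m W h a b q (2 * Ta + a) (3 * Fa + a) (2 * Tb + b) (3 * Fb + b) (S + 2 * q)
closedForm-identity {m} {W} {h} {a} {b} {q} {Ta} {Fa = Fa} {Tb = Tb} {Fb = Fb} {S = S} refl refl refl refl =
  closedForm-ring m W h a b q Ta Fa Tb Fb S

closedForm≡ddPoly : ∀ {h r a b q W a² a³ b² b³ 2q²} →
  W ≡ h * h + r * h → a² ≡ a * a → a³ ≡ a * a * a → b² ≡ b * b → b³ ≡ b * b * b → 2q² ≡ 2 * q * q →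
  closedForm (h + h + r) W h a b q a² a³ b² b³ 2q² ≡ ddPoly h r a b q
closedForm≡ddPoly refl refl refl refl refl refl = refl

ddPoly-gap : ∀ k r a b q →
  ddPoly (1 + k) r (1 + a) (1 + b) q + (1 + gapPoly k r a b q)
  ≡ 6 * (1 + k + (2 + k) + r + a + b + q) * (2 + k + (2 + k) + r + a + b + q) + ddPoly (2 + k) r a b q
ddPoly-gap = solve 5 (λ k r a b q →
    Expr.ddPoly (con 1 :+ k) r (con 1 :+ a) (con 1 :+ b) q :+ (con 1 :+ Expr.gapPoly k r a b q)
  := con 6 :* (con 1 :+ k :+ (con 2 :+ k) :+ r :+ a :+ b :+ q) :* (con 2 :+ k :+ (con 2 :+ k) :+ r :+ a :+ b :+ q)
     :+ Expr.ddPoly (con 2 :+ k) r a b q) refl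

-- The graph U

m<n+o⇒m∸n<o′ : ∀ {m n o} → n ≤ m → m < n + o → m ∸ n < o
m<n+o⇒m∸n<o′ {m} {n} {o} n≤m m<n+o = subst (_≤ o) (+-∸-assoc 1 n≤m) (m≤n+o⇒m∸n≤o (suc m) n m<n+o)

unicyclicGraph : (n m h a b q : ℕ) → Graph
unicyclicGraph n m h a b q =
  graph n (cycleEdges m ++ pathEdges 0 m a ++ pathEdges h (m + a) b ++ pendantEdges 0 (m + a + b) q)

-- Vertices of U by position: v_i on the cycle, the s-th vertex (s ≥ 1) of the path P_a at v_0
-- or of the path P_b at v_h, and the j-th pendant vertex at v_0.
data Site : Set where
  cyc pathA pathB pend : ℕ → Site

module Unicyclic (h r a b q : ℕ) (r≤1 : r ≤ 1) (3≤m : 3 ≤ h + h + r) (1≤a : 1 ≤ a) where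

  m = h + h + r
  open Cycle m public
  n = m + a + b + q

  1≤h : 1 ≤ h
  1≤h = ≰⇒> λ h≤0 → 3≰1 (≤-trans 3≤m (subst (λ k → k + k + r ≤ 1) (sym (n≤0⇒n≡0 h≤0)) r≤1))
    where
    3≰1 : ¬ 3 ≤ 1
    3≰1 (s≤s ())

  0<m : 0 < m
  0<m = ≤-trans 1≤h (≤-trans (m≤m+n h h) (m≤m+n (h + h) r))

  h<m : h < m
  h<m = ≤-trans (≤-reflexive (+-comm 1 h)) (≤-trans (+-monoʳ-≤ h 1≤h) (m≤m+n (h + h) r))

  site : ℕ → Site
  site v = if v <ᵇ m then cyc v
           else if v <ᵇ m + a then pathA (suc (v ∸ m))
           else if v <ᵇ m + a + b then pathB (suc (v ∸ (m + a)))
           else pend (v ∸ (m + a + b))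

  vertex : Site → ℕ
  vertex (cyc i) = i
  vertex (pathA s) = m + (s ∸ 1)
  vertex (pathB s) = m + a + (s ∸ 1)
  vertex (pend j) = m + a + b + j

  parentSite : Site → Site
  parentSite (cyc zero) = cyc (m ∸ 1)
  parentSite (cyc (suc i)) = cyc i
  parentSite (pathA zero) = cyc 0
  parentSite (pathA (suc zero)) = cyc 0
  parentSite (pathA (suc (suc s))) = pathA (suc s)
  parentSite (pathB zero) = cyc h
  parentSite (pathB (suc zero)) = cyc h
  parentSite (pathB (suc (suc s))) = pathB (suc s)
  parentSite (pend _) = cyc 0

  parent : ℕ → ℕ
  parent v = vertex (parentSite (site v))

  data Valid : Site → Set where
    cyc✓ : ∀ {i} → i < m → Valid (cyc i)
    pathA✓ : ∀ {i} → i < a → Valid (pathA (suc i))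
    pathB✓ : ∀ {i} → i < b → Valid (pathB (suc i))
    pend✓ : ∀ {j} → j < q → Valid (pend j)

  site-cyc : ∀ {i} → i < m → site i ≡ cyc i
  site-cyc i<m rewrite <ᵇ-true i<m = refl

  site-pathA : ∀ {i} → i < a → site (m + i) ≡ pathA (suc i)
  site-pathA {i} i<a rewrite <ᵇ-false (m≤m+n m i) | <ᵇ-true (+-monoʳ-< m i<a) | m+n∸m≡n m i = refl

  site-pathB : ∀ {i} → i < b → site (m + a + i) ≡ pathB (suc i)
  site-pathB {i} i<b rewrite <ᵇ-false (≤-trans (m≤m+n m a) (m≤m+n (m + a) i)) | <ᵇ-false (m≤m+n (m + a) i)
                           | <ᵇ-true (+-monoʳ-< (m + a) i<b) | m+n∸m≡n (m + a) i = refl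

  site-pend : ∀ j → site (m + a + b + j) ≡ pend j
  site-pend j rewrite <ᵇ-false (≤-trans (≤-trans (m≤m+n m a) (m≤m+n (m + a) b)) (m≤m+n (m + a + b) j))
                    | <ᵇ-false (≤-trans (m≤m+n (m + a) b) (m≤m+n (m + a + b) j))
                    | <ᵇ-false (m≤m+n (m + a + b) j) | m+n∸m≡n (m + a + b) j = refl

  site-vertex : ∀ {X} → Valid X → site (vertex X) ≡ X
  site-vertex (cyc✓ i<m) = site-cyc i<m
  site-vertex (pathA✓ i<a) = site-pathA i<a
  site-vertex (pathB✓ i<b) = site-pathB i<b
  site-vertex (pend✓ {j} _) = site-pend j

  vertex<n : ∀ {X} → Valid X → vertex X < n
  vertex<n (cyc✓ i<m) = ≤-trans i<m (≤-trans (m≤m+n m a) (≤-trans (m≤m+n (m + a) b) (m≤m+n (m + a + b) q)))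
  vertex<n (pathA✓ i<a) = ≤-trans (+-monoʳ-< m i<a) (≤-trans (m≤m+n (m + a) b) (m≤m+n (m + a + b) q))
  vertex<n (pathB✓ i<b) = ≤-trans (+-monoʳ-< (m + a) i<b) (m≤m+n (m + a + b) q)
  vertex<n (pend✓ j<q) = +-monoʳ-< (m + a + b) j<q

  vertex-onto : ∀ v → v < n → ∃[ X ] (Valid X × vertex X ≡ v)
  vertex-onto v v<n with v <? m
  ... | yes v<m = cyc v , cyc✓ v<m , refl
  ... | no v≮m with v <? m + a
  ... | yes p = pathA (suc (v ∸ m)) , pathA✓ (m<n+o⇒m∸n<o′ (≮⇒≥ v≮m) p) , m+[n∸m]≡n (≮⇒≥ v≮m)
  ... | no v≮m+a with v <? m + a + b
  ... | yes p = pathB (suc (v ∸ (m + a))) , pathB✓ (m<n+o⇒m∸n<o′ (≮⇒≥ v≮m+a) p) , m+[n∸m]≡n (≮⇒≥ v≮m+a)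
  ... | no v≮m+a+b = pend (v ∸ (m + a + b)) , pend✓ (m<n+o⇒m∸n<o′ (≮⇒≥ v≮m+a+b) v<n) , m+[n∸m]≡n (≮⇒≥ v≮m+a+b)

  site-valid : ∀ v → v < n → Valid (site v)
  site-valid v v<n with vertex-onto v v<n
  ... | X , vX , refl = subst Valid (sym (site-vertex vX)) vX

  vertex-site : ∀ v → v < n → vertex (site v) ≡ v
  vertex-site v v<n with vertex-onto v v<n
  ... | X , vX , refl = cong vertex (site-vertex vX)

  parentSite-valid : ∀ {X} → Valid X → Valid (parentSite X)
  parentSite-valid (cyc✓ {zero} _) = cyc✓ (∸-monoʳ-< {m} {1} {0} z<s 0<m)
  parentSite-valid (cyc✓ {suc i} i<m) = cyc✓ (≤-trans (n≤1+n _) i<m)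
  parentSite-valid (pathA✓ {zero} _) = cyc✓ 0<m
  parentSite-valid (pathA✓ {suc i} i<a) = pathA✓ (≤-trans (n≤1+n _) i<a)
  parentSite-valid (pathB✓ {zero} _) = cyc✓ h<m
  parentSite-valid (pathB✓ {suc i} i<b) = pathB✓ (≤-trans (n≤1+n _) i<b)
  parentSite-valid (pend✓ _) = cyc✓ 0<m

  parentSite-cyc : ∀ j → parentSite (cyc j) ≡ cyc (prev j)
  parentSite-cyc zero = refl
  parentSite-cyc (suc j) = refl

  parent-vertex : ∀ {X} → Valid X → parent (vertex X) ≡ vertex (parentSite X)
  parent-vertex vX = cong (λ Z → vertex (parentSite Z)) (site-vertex vX)

  site-parent : ∀ v → v < n → site (parent v) ≡ parentSite (site v)
  site-parent v v<n = site-vertex (parentSite-valid (site-valid v v<n))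

  parent<n : ∀ v → v < n → parent v < n
  parent<n v v<n = vertex<n (parentSite-valid (site-valid v v<n))

  edgesU : List (ℕ × ℕ)
  edgesU = cycleEdges m ++ pathEdges 0 m a ++ pathEdges h (m + a) b ++ pendantEdges 0 (m + a + b) q

  graphU : Graph
  graphU = unicyclicGraph n m h a b q

  ParentEdge : ℕ × ℕ → Set
  ParentEdge (u , v) = parent v ≡ u

  pathEdges-ParentEdge : ∀ k w s → (0 < k → parent s ≡ w) → (∀ i → suc i < k → parent (suc (s + i)) ≡ s + i) →
                         All ParentEdge (pathEdges w s k)
  pathEdges-ParentEdge zero w s _ _ = []
  pathEdges-ParentEdge (suc k) w s first next = first z<s ∷ pathEdges-ParentEdge k s (suc s)
    (λ 0<k → trans (cong parent (cong suc (sym (+-identityʳ s)))) (trans (next 0 (s<s 0<k)) (+-identityʳ s)))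
    (λ i i<k → trans (cong (λ z → parent (suc z)) (sym (+-suc s i))) (trans (next (suc i) (s<s i<k)) (+-suc s i)))

  edges-ParentEdge : All ParentEdge edgesU
  edges-ParentEdge =
    ++⁺ (++⁺ (map⁺ (applyUpTo⁺₁ (λ i → i) (m ∸ 1) (λ {i} → cycle-step i))) (parent-of (site-cyc 0<m) ∷ []))
    (++⁺ (pathEdges-ParentEdge a 0 m (λ 0<a → parent-of (trans (cong site (sym (+-identityʳ m))) (site-pathA 0<a)))
                                     (λ i i<a → parent-of (trans (cong site (sym (+-suc m i))) (site-pathA i<a))))
    (++⁺ (pathEdges-ParentEdge b h (m + a) (λ 0<b → parent-of (trans (cong site (sym (+-identityʳ (m + a)))) (site-pathB 0<b)))
                                           (λ i i<b → parent-of (trans (cong site (sym (+-suc (m + a) i))) (site-pathB i<b))))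
         (map⁺ (applyUpTo⁺₁ (λ i → i) q (λ {j} _ → parent-of (site-pend j))))))
    where
    parent-of : ∀ {v X} → site v ≡ X → parent v ≡ vertex (parentSite X)
    parent-of = cong (λ Z → vertex (parentSite Z))
    cycle-step : ∀ i → i < m ∸ 1 → parent (suc i) ≡ i
    cycle-step i i<m-1 = parent-of (site-cyc (subst (suc (suc i) ≤_) (sym (+-∸-assoc 1 0<m)) (s≤s i<m-1)))

  pathEdge∈ : ∀ k w s i → suc i < k → (s + i , suc (s + i)) ∈ pathEdges w s k
  pathEdge∈ (suc (suc k)) w s zero _ = there (here (cong₂ _,_ (+-identityʳ s) (cong suc (+-identityʳ s))))
  pathEdge∈ (suc k) w s (suc i) (s≤s i<k) =
    there (subst (λ z → (z , suc z) ∈ pathEdges s (suc s) k) (sym (+-suc s i)) (pathEdge∈ k s (suc s) i i<k))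

  private
    ∈-cycle : ∀ {e} → e ∈ cycleEdges m → e ∈ edgesU
    ∈-cycle = ∈-++⁺ˡ
    ∈-pathA : ∀ {e} → e ∈ pathEdges 0 m a → e ∈ edgesU
    ∈-pathA e∈ = ∈-++⁺ʳ (cycleEdges m) (∈-++⁺ˡ e∈)
    ∈-pathB : ∀ {e} → e ∈ pathEdges h (m + a) b → e ∈ edgesU
    ∈-pathB e∈ = ∈-++⁺ʳ (cycleEdges m) (∈-++⁺ʳ (pathEdges 0 m a) (∈-++⁺ˡ e∈))
    ∈-pend : ∀ {e} → e ∈ pendantEdges 0 (m + a + b) q → e ∈ edgesU
    ∈-pend e∈ = ∈-++⁺ʳ (cycleEdges m) (∈-++⁺ʳ (pathEdges 0 m a) (∈-++⁺ʳ (pathEdges h (m + a) b) e∈))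

  siteParentEdge∈ : ∀ {X} → Valid X → (vertex (parentSite X) , vertex X) ∈ edgesU
  siteParentEdge∈ (cyc✓ {zero} _) = ∈-cycle (∈-++⁺ʳ (map (λ i → (i , suc i)) (upTo (m ∸ 1))) (here refl))
  siteParentEdge∈ (cyc✓ {suc i} i<m) = ∈-cycle (∈-++⁺ˡ (∈-map⁺ (λ i → (i , suc i)) (∈-upTo⁺ (∸-monoˡ-< {suc i} {1} {m} i<m z<s))))
  siteParentEdge∈ (pathA✓ {zero} (s≤s _)) = ∈-pathA (here (cong (0 ,_) (+-identityʳ m)))
  siteParentEdge∈ (pathA✓ {suc i} i<a) =
    ∈-pathA (subst (λ z → (m + i , z) ∈ pathEdges 0 m a) (sym (+-suc m i)) (pathEdge∈ a 0 m i i<a))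
  siteParentEdge∈ (pathB✓ {zero} (s≤s _)) = ∈-pathB (here (cong (h ,_) (+-identityʳ (m + a))))
  siteParentEdge∈ (pathB✓ {suc i} i<b) =
    ∈-pathB (subst (λ z → (m + a + i , z) ∈ pathEdges h (m + a) b) (sym (+-suc (m + a) i)) (pathEdge∈ b h (m + a) i i<b))
  siteParentEdge∈ (pend✓ j<q) = ∈-pend (∈-map⁺ (λ j → (0 , m + a + b + j)) (∈-upTo⁺ j<q))

  parentEdge∈ : ∀ v → v < n → (parent v , v) ∈ edgesU
  parentEdge∈ v v<n with vertex-onto v v<n
  ... | X , vX , refl = subst (λ z → (z , vertex X) ∈ edgesU) (sym (parent-vertex vX)) (siteParentEdge∈ vX)

  private
    edgeTest : ℕ → ℕ → ℕ × ℕ → Bool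
    edgeTest x y (u , v) = ((u ≡ᵇ x) ∧ (v ≡ᵇ y)) ∨ ((u ≡ᵇ y) ∧ (v ≡ᵇ x))

    ∨-∧-true⁻ : ∀ A B C D → ((A ∧ B) ∨ (C ∧ D)) ≡ true → (A ≡ true × B ≡ true) ⊎ (C ≡ true × D ≡ true)
    ∨-∧-true⁻ true true C D e = inj₁ (refl , refl)
    ∨-∧-true⁻ true false true true e = inj₂ (refl , refl)
    ∨-∧-true⁻ false B true true e = inj₂ (refl , refl)

  adj⇒parent : ∀ z y → adj graphU z y ≡ true → (parent y ≡ z) ⊎ (parent z ≡ y)
  adj⇒parent z y e with any-All (edgeTest z y) {ParentEdge} edgesU e edges-ParentEdge
  ... | (u , v) , pv≡u , test with ∨-∧-true⁻ (u ≡ᵇ z) (v ≡ᵇ y) (u ≡ᵇ y) (v ≡ᵇ z) test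
  ... | inj₁ (u≡z , v≡y) = inj₁ (trans (cong parent (sym (≡ᵇ-true⇒≡ v≡y))) (trans pv≡u (≡ᵇ-true⇒≡ u≡z)))
  ... | inj₂ (u≡y , v≡z) = inj₂ (trans (cong parent (sym (≡ᵇ-true⇒≡ v≡z))) (trans pv≡u (≡ᵇ-true⇒≡ u≡y)))

  adj-parent-child : ∀ v → v < n → adj graphU (parent v) v ≡ true
  adj-parent-child v v<n = any-∈ (edgeTest (parent v) v) (parentEdge∈ v v<n)
    (cong₂ (λ x y → (x ∧ y) ∨ ((parent v ≡ᵇ v) ∧ (v ≡ᵇ parent v))) (≡ᵇ-refl (parent v)) (≡ᵇ-refl v))

  adj-child-parent : ∀ v → v < n → adj graphU v (parent v) ≡ true
  adj-child-parent v v<n = any-∈ (edgeTest v (parent v)) (parentEdge∈ v v<n)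
    (trans (cong₂ (λ x y → ((parent v ≡ᵇ v) ∧ (v ≡ᵇ parent v)) ∨ (x ∧ y)) (≡ᵇ-refl (parent v)) (≡ᵇ-refl v)) (∨-zeroʳ _))

  depth : Site → ℕ
  depth (cyc _) = 0
  depth (pathA s) = s
  depth (pathB s) = s
  depth (pend _) = 1

  root : Site → ℕ
  root (cyc i) = i
  root (pathA _) = 0
  root (pathB _) = h
  root (pend _) = 0

  siteDist : Site → Site → ℕ
  siteDist (pathA s) (pathA t) = ∣ s - t ∣
  siteDist (pathB s) (pathB t) = ∣ s - t ∣
  siteDist (pend j) (pend k) = if j ≡ᵇ k then 0 else 2
  siteDist X Y = depth X + depth Y + cdist (root X) (root Y)

  siteDist-self : ∀ X → siteDist X X ≡ 0
  siteDist-self (cyc i) = cdist-self i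
  siteDist-self (pathA s) = ∣n-n∣≡0 s
  siteDist-self (pathB s) = ∣n-n∣≡0 s
  siteDist-self (pend j) rewrite ≡ᵇ-refl j = refl

  siteDist≡0⇒≡ : ∀ {X Y} → Valid X → Valid Y → siteDist X Y ≡ 0 → X ≡ Y
  siteDist≡0⇒≡ (cyc✓ {i} i<m) (cyc✓ {j} j<m) e = cong cyc (cdist≡0⇒≡ i j i<m j<m e)
  siteDist≡0⇒≡ (pathA✓ _) (pathA✓ _) e = cong pathA (∣m-n∣≡0⇒m≡n e)
  siteDist≡0⇒≡ (pathB✓ _) (pathB✓ _) e = cong pathB (∣m-n∣≡0⇒m≡n e)
  siteDist≡0⇒≡ (pend✓ {j} _) (pend✓ {k} _) e with j ≡ᵇ k in j≡k
  ... | true = cong pend (≡ᵇ-true⇒≡ j≡k)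
  siteDist≡0⇒≡ (cyc✓ _) (pathA✓ _) ()
  siteDist≡0⇒≡ (cyc✓ _) (pathB✓ _) ()
  siteDist≡0⇒≡ (cyc✓ _) (pend✓ _) ()
  siteDist≡0⇒≡ (pathA✓ _) (cyc✓ _) ()
  siteDist≡0⇒≡ (pathA✓ _) (pathB✓ _) ()
  siteDist≡0⇒≡ (pathA✓ _) (pend✓ _) ()
  siteDist≡0⇒≡ (pathB✓ _) (cyc✓ _) ()
  siteDist≡0⇒≡ (pathB✓ _) (pathA✓ _) ()
  siteDist≡0⇒≡ (pathB✓ _) (pend✓ _) ()
  siteDist≡0⇒≡ (pend✓ _) (cyc✓ _) ()
  siteDist≡0⇒≡ (pend✓ _) (pathA✓ _) ()
  siteDist≡0⇒≡ (pend✓ _) (pathB✓ _) ()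

  private
    Near-suc′ : ∀ {x y} → y ≡ suc x → Near x y
    Near-suc′ e = Near-sym (Near-suc e)

    +-suc-middle : ∀ x y c → x + suc y + c ≡ suc (x + y + c)
    +-suc-middle x y c = cong (_+ c) (+-suc x y)

  siteDist-near-parent : ∀ {X V} → Valid X → Valid V → Near (siteDist X V) (siteDist X (parentSite V))
  siteDist-near-parent {cyc i} (cyc✓ i<m) (cyc✓ {j} j<m) rewrite parentSite-cyc j = cdist-near-prev i j i<m j<m
  siteDist-near-parent {pathA s} (pathA✓ _) (cyc✓ {j} j<m) rewrite parentSite-cyc j = Near-+ˡ (s + 0) (cdist-near-prev 0 j 0<m j<m)
  siteDist-near-parent {pathB s} (pathB✓ _) (cyc✓ {j} j<m) rewrite parentSite-cyc j = Near-+ˡ (s + 0) (cdist-near-prev h j h<m j<m)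
  siteDist-near-parent {pend k} (pend✓ _) (cyc✓ {j} j<m) rewrite parentSite-cyc j = Near-+ˡ 1 (cdist-near-prev 0 j 0<m j<m)
  siteDist-near-parent (cyc✓ _) (pathA✓ {zero} _) = Near-suc refl
  siteDist-near-parent (cyc✓ _) (pathA✓ {suc t} _) = Near-suc refl
  siteDist-near-parent {pathA (suc s)} (pathA✓ _) (pathA✓ {zero} _) =
    Near-suc′ (cong suc (trans (trans (+-identityʳ (s + 0)) (+-identityʳ s)) (sym (∣-∣-identityʳ s))))
  siteDist-near-parent {pathA s} (pathA✓ _) (pathA✓ {suc t} _) with ∣-∣-step s (suc t)
  ... | inj₁ e = Near-suc e
  ... | inj₂ e = Near-suc′ e
  siteDist-near-parent {pathB s} (pathB✓ _) (pathA✓ {zero} _) = Near-suc (+-suc-middle s 0 (cdist h 0))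
  siteDist-near-parent {pathB s} (pathB✓ _) (pathA✓ {suc t} _) = Near-suc (+-suc-middle s (suc t) (cdist h 0))
  siteDist-near-parent (pend✓ _) (pathA✓ {zero} _) = Near-suc refl
  siteDist-near-parent (pend✓ _) (pathA✓ {suc t} _) = Near-suc refl
  siteDist-near-parent (cyc✓ _) (pathB✓ {zero} _) = Near-suc refl
  siteDist-near-parent (cyc✓ _) (pathB✓ {suc t} _) = Near-suc refl
  siteDist-near-parent {pathB (suc s)} (pathB✓ _) (pathB✓ {zero} _) =
    Near-suc′ (cong suc (trans (trans (cong (s + 0 +_) (cdist-self h)) (trans (+-identityʳ _) (+-identityʳ s)))
                               (sym (∣-∣-identityʳ s))))
  siteDist-near-parent {pathB s} (pathB✓ _) (pathB✓ {suc t} _) with ∣-∣-step s (suc t)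
  ... | inj₁ e = Near-suc e
  ... | inj₂ e = Near-suc′ e
  siteDist-near-parent {pathA s} (pathA✓ _) (pathB✓ {zero} _) = Near-suc (+-suc-middle s 0 (cdist 0 h))
  siteDist-near-parent {pathA s} (pathA✓ _) (pathB✓ {suc t} _) = Near-suc (+-suc-middle s (suc t) (cdist 0 h))
  siteDist-near-parent (pend✓ _) (pathB✓ {zero} _) = Near-suc refl
  siteDist-near-parent (pend✓ _) (pathB✓ {suc t} _) = Near-suc refl
  siteDist-near-parent (cyc✓ _) (pend✓ _) = Near-suc refl
  siteDist-near-parent {pathA s} (pathA✓ _) (pend✓ _) = Near-suc (+-suc-middle s 0 0)
  siteDist-near-parent {pathB s} (pathB✓ _) (pend✓ _) = Near-suc (+-suc-middle s 0 (cdist h 0))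
  siteDist-near-parent {pend k} (pend✓ _) (pend✓ {j} _) with k ≡ᵇ j
  ... | true = Near-suc′ refl
  ... | false = Near-suc refl

  SiteAdj : Site → Site → Set
  SiteAdj Z Y = (parentSite Z ≡ Y) ⊎ (parentSite Y ≡ Z)

  Descent : Site → Site → Set
  Descent X Y = ∃[ Z ] (Valid Z × SiteAdj Z Y × suc (siteDist X Z) ≡ siteDist X Y)

  private
    suc-+ : ∀ x {c c′} → suc c ≡ c′ → suc (x + c) ≡ x + c′
    suc-+ x {c} refl = sym (+-suc x c)

    cycleAdj⇒siteAdj : ∀ {j′ j} → CycleAdj j′ j → SiteAdj (cyc j′) (cyc j)
    cycleAdj⇒siteAdj {j′} {j} (inj₁ e) = inj₂ (trans (parentSite-cyc j) (cong cyc e))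
    cycleAdj⇒siteAdj {j′} {j} (inj₂ e) = inj₁ (trans (parentSite-cyc j′) (cong cyc e))

    0≮ : ∀ {x} → x ≡ 0 → ¬ 0 < x
    0≮ refl ()

    cycle-descent : ∀ c i j → i < m → j < m → ¬ i ≡ j →
                    ∃[ j′ ] (Valid (cyc j′) × SiteAdj (cyc j′) (cyc j) × suc (c + cdist i j′) ≡ c + cdist i j)
    cycle-descent c i j i<m j<m i≢j with cdist-descent i j i<m j<m i≢j
    ... | j′ , j′<m , adj′ , e = j′ , cyc✓ j′<m , cycleAdj⇒siteAdj adj′ , suc-+ c e

    Descent-cyc : ∀ {X} c i j → i < m → j < m → ¬ i ≡ j →
                  (∀ {j′} → siteDist X (cyc j′) ≡ c + cdist i j′) → Descent X (cyc j)
    Descent-cyc c i j i<m j<m i≢j dist with cycle-descent c i j i<m j<m i≢j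
    ... | j′ , v , adj′ , e = cyc j′ , v , adj′ , trans (cong suc dist) (trans e (sym dist))

    path-descent : ∀ (P : ℕ → Site) {L} → (∀ {i} → i < L → Valid (P (suc i))) →
                   (∀ i → parentSite (P (suc (suc i))) ≡ P (suc i)) → (∀ s t → siteDist (P s) (P t) ≡ ∣ s - t ∣) →
                   ∀ {s t} → s < L → t < L → 0 < ∣ s - t ∣ → Descent (P (suc s)) (P (suc t))
    path-descent P P✓ parent-P dist-P {s} {t} s<L t<L pos with compare′ s t
    ... | equal refl = ⊥-elim (0≮ (∣n-n∣≡0 s) pos)
    ... | less k refl =
      P (suc (s + k)) , P✓ (≤-trans (≤-reflexive (sym (+-suc s k))) (<⇒≤ t<L)) ,
      inj₂ (trans (cong (λ z → parentSite (P (suc z))) (+-suc s k)) (parent-P (s + k))) ,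
      (begin
        suc (siteDist (P (suc s)) (P (suc (s + k)))) ≡⟨ cong suc (trans (dist-P _ _) (∣m-m+n∣≡n s k)) ⟩
        suc k                                        ≡⟨ sym (trans (dist-P _ _) (∣m-m+n∣≡n s (suc k))) ⟩
        siteDist (P (suc s)) (P (suc (s + suc k)))   ∎)
      where open ≡-Reasoning
    ... | greater k refl =
      P (suc (suc t)) , P✓ (≤-<-trans (≤-trans (s≤s (m≤m+n t k)) (≤-reflexive (sym (+-suc t k)))) s<L) ,
      inj₁ (parent-P t) ,
      (begin
        suc (siteDist (P (suc (t + suc k))) (P (suc (suc t)))) ≡⟨ cong suc (trans (dist-P _ _) (trans (cong (λ z → ∣ z - suc t ∣) (+-suc t k)) (∣m+n-m∣≡n (suc t) k))) ⟩
        suc k                                                 ≡⟨ sym (trans (dist-P _ _) (∣m+n-m∣≡n t (suc k))) ⟩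
        siteDist (P (suc (t + suc k))) (P (suc t))            ∎)
      where open ≡-Reasoning

  siteDist-descent : ∀ {X Y} → Valid X → Valid Y → 0 < siteDist X Y → Descent X Y
  siteDist-descent (cyc✓ {i} i<m) (cyc✓ {j} j<m) pos with i ≟ j
  ... | yes refl = ⊥-elim (0≮ (cdist-self i) pos)
  ... | no i≢j = Descent-cyc {cyc i} 0 i j i<m j<m i≢j refl
  siteDist-descent (cyc✓ _) (pathA✓ {zero} _) _ = cyc 0 , cyc✓ 0<m , inj₂ refl , refl
  siteDist-descent (cyc✓ _) (pathA✓ {suc t} t<a) _ = pathA (suc t) , pathA✓ (≤-trans (n≤1+n _) t<a) , inj₂ refl , refl
  siteDist-descent (cyc✓ _) (pathB✓ {zero} _) _ = cyc h , cyc✓ h<m , inj₂ refl , refl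
  siteDist-descent (cyc✓ _) (pathB✓ {suc t} t<b) _ = pathB (suc t) , pathB✓ (≤-trans (n≤1+n _) t<b) , inj₂ refl , refl
  siteDist-descent (cyc✓ _) (pend✓ _) _ = cyc 0 , cyc✓ 0<m , inj₂ refl , refl
  siteDist-descent (pathA✓ {s} s<a) (cyc✓ {zero} _) _ =
    pathA 1 , pathA✓ (≤-trans (s≤s z≤n) s<a) , inj₁ refl ,
    cong suc (trans (∣-∣-identityʳ s) (sym (trans (+-identityʳ (s + 0)) (+-identityʳ s))))
  siteDist-descent (pathA✓ {s} _) (cyc✓ {suc j} j<m) _ = Descent-cyc {pathA (suc s)} (suc s + 0) 0 (suc j) 0<m j<m (λ ()) refl
  siteDist-descent (pathA✓ s<a) (pathA✓ t<a) pos = path-descent pathA pathA✓ (λ _ → refl) (λ _ _ → refl) s<a t<a pos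
  siteDist-descent (pathA✓ {s} _) (pathB✓ {zero} _) _ = cyc h , cyc✓ h<m , inj₂ refl , sym (+-suc-middle (suc s) 0 (cdist 0 h))
  siteDist-descent (pathA✓ {s} _) (pathB✓ {suc t} t<b) _ =
    pathB (suc t) , pathB✓ (≤-trans (n≤1+n _) t<b) , inj₂ refl , sym (+-suc-middle (suc s) (suc t) (cdist 0 h))
  siteDist-descent (pathA✓ {s} _) (pend✓ _) _ = cyc 0 , cyc✓ 0<m , inj₂ refl , sym (+-suc-middle (suc s) 0 (cdist 0 0))
  siteDist-descent (pathB✓ {s} s<b) (cyc✓ {j} j<m) _ with j ≟ h
  ... | yes refl = pathB 1 , pathB✓ (≤-trans (s≤s z≤n) s<b) , inj₁ refl ,
                   cong suc (trans (∣-∣-identityʳ s) (sym (trans (cong (s + 0 +_) (cdist-self h)) (trans (+-identityʳ (s + 0)) (+-identityʳ s)))))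
  ... | no j≢h = Descent-cyc {pathB (suc s)} (suc s + 0) h j h<m j<m (λ h≡j → j≢h (sym h≡j)) refl
  siteDist-descent (pathB✓ s<b) (pathB✓ t<b) pos = path-descent pathB pathB✓ (λ _ → refl) (λ _ _ → refl) s<b t<b pos
  siteDist-descent (pathB✓ {s} _) (pathA✓ {zero} _) _ = cyc 0 , cyc✓ 0<m , inj₂ refl , sym (+-suc-middle (suc s) 0 (cdist h 0))
  siteDist-descent (pathB✓ {s} _) (pathA✓ {suc t} t<a) _ =
    pathA (suc t) , pathA✓ (≤-trans (n≤1+n _) t<a) , inj₂ refl , sym (+-suc-middle (suc s) (suc t) (cdist h 0))
  siteDist-descent (pathB✓ {s} _) (pend✓ _) _ = cyc 0 , cyc✓ 0<m , inj₂ refl , sym (+-suc-middle (suc s) 0 (cdist h 0))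
  siteDist-descent (pend✓ {k} k<q) (cyc✓ {zero} _) _ = pend k , pend✓ k<q , inj₁ refl , cong suc (siteDist-self (pend k))
  siteDist-descent (pend✓ {k} _) (cyc✓ {suc j} j<m) _ = Descent-cyc {pend k} 1 0 (suc j) 0<m j<m (λ ()) refl
  siteDist-descent (pend✓ _) (pathA✓ {zero} _) _ = cyc 0 , cyc✓ 0<m , inj₂ refl , refl
  siteDist-descent (pend✓ _) (pathA✓ {suc t} t<a) _ = pathA (suc t) , pathA✓ (≤-trans (n≤1+n _) t<a) , inj₂ refl , refl
  siteDist-descent (pend✓ _) (pathB✓ {zero} _) _ = cyc h , cyc✓ h<m , inj₂ refl , refl
  siteDist-descent (pend✓ _) (pathB✓ {suc t} t<b) _ = pathB (suc t) , pathB✓ (≤-trans (n≤1+n _) t<b) , inj₂ refl , refl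
  siteDist-descent (pend✓ {k} _) (pend✓ {j} _) pos with k ≡ᵇ j
  ... | true = ⊥-elim (0≮ refl pos)
  ... | false = cyc 0 , cyc✓ 0<m , inj₂ refl , refl

  cycleDist≤h : ∀ k → cycleDist k ≤ h
  cycleDist≤h k with k ≤? h
  ... | yes k≤h = ≤-trans (m⊓n≤m k (m ∸ k)) k≤h
  ... | no k≰h = ≤-trans (m⊓n≤n k (m ∸ k)) (≤-trans (∸-monoˡ-≤ k m≤h+k) (≤-reflexive (m+n∸n≡m h k)))
    where
    m≤h+k : m ≤ h + k
    m≤h+k = ≤-trans (≤-reflexive (+-assoc h h r))
              (+-monoʳ-≤ h (≤-trans (+-monoʳ-≤ h r≤1) (≤-trans (≤-reflexive (+-comm h 1)) (≰⇒> k≰h))))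

  cdist≤h : ∀ i j → cdist i j ≤ h
  cdist≤h i j = cycleDist≤h ∣ i - j ∣

  cdist-0-h : cdist 0 h ≡ h
  cdist-0-h = m≤n⇒m⊓n≡m (≤-trans (m≤m+n h r) (≤-reflexive (sym (+≡⇒∸≡ {m} {h} {h + r} (sym (+-assoc h h r))))))

  cdist-h-0 : cdist h 0 ≡ h
  cdist-h-0 = trans (cdist-sym h 0) cdist-0-h

  diam : ℕ
  diam = a + b + h

  private
    ≤diam : ∀ {t} u v w → t ≡ u + v + w → u ≤ a → v ≤ b → w ≤ h → t ≤ diam
    ≤diam u v w refl u≤a v≤b w≤h = +-mono-≤ (+-mono-≤ u≤a v≤b) w≤h

    swap₁₂ : ∀ x y c → x + y + c ≡ y + x + c
    swap₁₂ x y c = cong (_+ c) (+-comm x y)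

    swap₂₃ : ∀ x y c → x + y + c ≡ x + c + y
    swap₂₃ x y c = trans (+-assoc x y c) (trans (cong (x +_) (+-comm y c)) (sym (+-assoc x c y)))

  siteDist≤diam : ∀ {X Y} → Valid X → Valid Y → siteDist X Y ≤ diam
  siteDist≤diam (cyc✓ {i} _) (cyc✓ {j} _) = ≤diam 0 0 (cdist i j) refl z≤n z≤n (cdist≤h i j)
  siteDist≤diam (cyc✓ {i} _) (pathA✓ {s} s<a) = ≤diam (suc s) 0 (cdist i 0) (cong (_+ cdist i 0) (sym (+-identityʳ (suc s)))) s<a z≤n (cdist≤h i 0)
  siteDist≤diam (cyc✓ {i} _) (pathB✓ {s} s<b) = ≤diam 0 (suc s) (cdist i h) refl z≤n s<b (cdist≤h i h)
  siteDist≤diam (cyc✓ {i} _) (pend✓ _) = ≤diam 1 0 (cdist i 0) refl 1≤a z≤n (cdist≤h i 0)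
  siteDist≤diam (pathA✓ {s} s<a) (cyc✓ {j} _) = ≤diam (suc s) 0 (cdist 0 j) refl s<a z≤n (cdist≤h 0 j)
  siteDist≤diam (pathA✓ {s} s<a) (pathA✓ {t} t<a) =
    ≤-trans (∣m-n∣≤m⊔n (suc s) (suc t)) (≤-trans (⊔-lub s<a t<a) (≤-trans (m≤m+n a b) (m≤m+n (a + b) h)))
  siteDist≤diam (pathA✓ {s} s<a) (pathB✓ {t} t<b) = ≤diam (suc s) (suc t) (cdist 0 h) refl s<a t<b (cdist≤h 0 h)
  siteDist≤diam (pathA✓ {s} s<a) (pend✓ _) = ≤diam (suc s) 0 1 (swap₂₃ (suc s) 1 0) s<a z≤n 1≤h
  siteDist≤diam (pathB✓ {s} s<b) (cyc✓ {j} _) = ≤diam 0 (suc s) (cdist h j) (swap₁₂ (suc s) 0 (cdist h j)) z≤n s<b (cdist≤h h j)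
  siteDist≤diam (pathB✓ {s} s<b) (pathA✓ {t} t<a) = ≤diam (suc t) (suc s) (cdist h 0) (swap₁₂ (suc s) (suc t) (cdist h 0)) t<a s<b (cdist≤h h 0)
  siteDist≤diam (pathB✓ {s} s<b) (pathB✓ {t} t<b) =
    ≤-trans (∣m-n∣≤m⊔n (suc s) (suc t)) (≤-trans (⊔-lub s<b t<b) (≤-trans (m≤n+m b a) (m≤m+n (a + b) h)))
  siteDist≤diam (pathB✓ {s} s<b) (pend✓ _) = ≤diam 1 (suc s) (cdist h 0) (swap₁₂ (suc s) 1 (cdist h 0)) 1≤a s<b (cdist≤h h 0)
  siteDist≤diam (pend✓ _) (cyc✓ {j} _) = ≤diam 1 0 (cdist 0 j) refl 1≤a z≤n (cdist≤h 0 j)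
  siteDist≤diam (pend✓ _) (pathA✓ {s} s<a) = ≤diam (suc s) 0 1 (+-comm 1 (suc s + 0)) s<a z≤n 1≤h
  siteDist≤diam (pend✓ _) (pathB✓ {s} s<b) = ≤diam 1 (suc s) (cdist 0 h) refl 1≤a s<b (cdist≤h 0 h)
  siteDist≤diam (pend✓ {j} _) (pend✓ {k} _) with j ≡ᵇ k
  ... | true = z≤n
  ... | false = ≤diam 1 0 1 refl 1≤a z≤n 1≤h

  diam<n : diam < n
  diam<n = ≤-trans (≤-reflexive (sym (+-suc (a + b) h)))
             (≤-trans (+-monoʳ-≤ (a + b) h<m) (≤-trans (≤-reflexive a+b+m≡m+a+b) (m≤m+n (m + a + b) q)))
    where
    a+b+m≡m+a+b : a + b + m ≡ m + a + b
    a+b+m≡m+a+b = trans (+-comm (a + b) m) (sym (+-assoc m a b))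

  δ : ℕ → ℕ → ℕ
  δ x y = siteDist (site x) (site y)

  δ≤diam : ∀ x y → x < n → y < n → δ x y ≤ diam
  δ≤diam x y x<n y<n = siteDist≤diam (site-valid x x<n) (site-valid y y<n)

  dist≡δ : ∀ x y → x < n → y < n → dist graphU x y ≡ δ x y
  dist≡δ x y x<n y<n = DistanceCharacterisation.dist≡δ graphU x (δ x)
    (siteDist-self (site x)) δ≡0⇒≡ δ-edge δ-descent y y<n (≤-<-trans (δ≤diam x y x<n y<n) diam<n)
    where
    vx = site-valid x x<n

    δ≡0⇒≡ : ∀ y → y < n → δ x y ≡ 0 → x ≡ y
    δ≡0⇒≡ y y<n e = trans (sym (vertex-site x x<n))
                      (trans (cong vertex (siteDist≡0⇒≡ vx (site-valid y y<n) e)) (vertex-site y y<n))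

    δ-edge : ∀ z y → z < n → y < n → adj graphU z y ≡ true → δ x y ≤ suc (δ x z)
    δ-edge z y z<n y<n e with adj⇒parent z y e
    ... | inj₁ refl = subst (λ w → δ x y ≤ suc (siteDist (site x) w)) (sym (site-parent y y<n))
                        (proj₁ (siteDist-near-parent vx (site-valid y y<n)))
    ... | inj₂ refl = subst (λ w → siteDist (site x) w ≤ suc (δ x z)) (sym (site-parent z z<n))
                        (proj₂ (siteDist-near-parent vx (site-valid z z<n)))

    δ-descent : ∀ y → y < n → 0 < δ x y → ∃[ z ] (z < n × adj graphU z y ≡ true × suc (δ x z) ≡ δ x y)
    δ-descent y y<n pos with siteDist-descent vx (site-valid y y<n) pos
    ... | Z , vZ , inj₁ pZ≡y , d =
      vertex Z , vertex<n vZ ,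
      subst (λ w → adj graphU (vertex Z) w ≡ true) (trans (parent-vertex vZ) (trans (cong vertex pZ≡y) (vertex-site y y<n)))
        (adj-child-parent (vertex Z) (vertex<n vZ)) ,
      trans (cong (λ w → suc (siteDist (site x) w)) (site-vertex vZ)) d
    ... | Z , vZ , inj₂ py≡Z , d =
      vertex Z , vertex<n vZ ,
      subst (λ w → adj graphU w y ≡ true) (cong vertex py≡Z) (adj-parent-child y y<n) ,
      trans (cong (λ w → suc (siteDist (site x) w)) (site-vertex vZ)) d

  private
    eccentricity : ℕ → ℕ
    eccentricity x = maximum (map (dist graphU x) (upTo n))

  eccentricity≤diam : ∀ x → x < n → eccentricity x ≤ diam
  eccentricity≤diam x x<n = subst (_≤ diam) (sym (cong maximum (map-upTo (dist graphU x) n)))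
    (maximum-applyUpTo-≤ (dist graphU x) n diam
      (λ y y<n → subst (_≤ diam) (sym (dist≡δ x y x<n y<n)) (δ≤diam x y x<n y<n)))

  diametral-pair : ∃[ X ] ∃[ Y ] (Valid X × Valid Y × siteDist X Y ≡ diam)
  diametral-pair with b ≟ 0
  ... | yes refl = pathA (suc (a ∸ 1)) , cyc h , pathA✓ (≤-reflexive a-1+1≡a) , cyc✓ h<m ,
                   cong₂ _+_ (trans (+-identityʳ _) (trans a-1+1≡a (sym (+-identityʳ a)))) cdist-0-h
    where
    a-1+1≡a : suc (a ∸ 1) ≡ a
    a-1+1≡a = m+[n∸m]≡n 1≤a
  ... | no b≢0 = pathA (suc (a ∸ 1)) , pathB (suc (b ∸ 1)) , pathA✓ (≤-reflexive (m+[n∸m]≡n 1≤a)) ,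
                 pathB✓ (≤-reflexive (m+[n∸m]≡n 1≤b)) , cong₂ _+_ (cong₂ _+_ (m+[n∸m]≡n 1≤a) (m+[n∸m]≡n 1≤b)) cdist-0-h
    where
    1≤b : 1 ≤ b
    1≤b = n≢0⇒n>0 b≢0

  diameter≡diam : diameter graphU ≡ diam
  diameter≡diam = ≤-antisym diameter≤diam diam≤diameter
    where
    diameter≡max : diameter graphU ≡ maximum (applyUpTo eccentricity n)
    diameter≡max = cong maximum (map-upTo eccentricity n)

    diameter≤diam : diameter graphU ≤ diam
    diameter≤diam = subst (_≤ diam) (sym diameter≡max) (maximum-applyUpTo-≤ eccentricity n diam eccentricity≤diam)

    diam≤diameter : diam ≤ diameter graphU
    diam≤diameter with diametral-pair
    ... | X , Y , vX , vY , dXY = subst (diam ≤_) (sym diameter≡max) (begin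
      diam                        ≡⟨ sym dXY ⟩
      siteDist X Y                ≡⟨ sym (cong₂ siteDist (site-vertex vX) (site-vertex vY)) ⟩
      δ x y                       ≡⟨ sym (dist≡δ x y (vertex<n vX) (vertex<n vY)) ⟩
      dist graphU x y             ≤⟨ subst (dist graphU x y ≤_) (sym (cong maximum (map-upTo (dist graphU x) n)))
                                         (≤-maximum-applyUpTo (dist graphU x) n y (vertex<n vY)) ⟩
      eccentricity x              ≤⟨ ≤-maximum-applyUpTo eccentricity n x (vertex<n vX) ⟩
      maximum (applyUpTo eccentricity n) ∎)
      where
      open ≤-Reasoning
      x = vertex X
      y = vertex Y

  private
    m∸1≡suc[m∸2] : m ∸ 1 ≡ suc (m ∸ 2)
    m∸1≡suc[m∸2] = +-∸-assoc 1 {m} {2} (≤-trans (s≤s (s≤s z≤n)) 3≤m)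

    m∸2≡suc[m∸3] : m ∸ 2 ≡ suc (m ∸ 3)
    m∸2≡suc[m∸3] = +-∸-assoc 1 {m} {3} 3≤m

    cyc-injective : ∀ {i j} → cyc i ≡ cyc j → i ≡ j
    cyc-injective refl = refl

  parentSite≢ : ∀ {X} → Valid X → ¬ parentSite X ≡ X
  parentSite≢ (cyc✓ {zero} _) e = 0≢1+n (sym (trans (sym m∸1≡suc[m∸2]) (cyc-injective e)))
  parentSite≢ (cyc✓ {suc i} _) e = <-irrefl (cyc-injective e) ≤-refl
  parentSite≢ (pathA✓ {zero} _) ()
  parentSite≢ (pathA✓ {suc i} _) ()
  parentSite≢ (pathB✓ {zero} _) ()
  parentSite≢ (pathB✓ {suc i} _) ()
  parentSite≢ (pend✓ _) ()

  -- This is where m ≥ 3 is needed: on a 2-cycle a vertex would be its parent's parent.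
  parentSite²≢ : ∀ {X} → Valid X → ¬ parentSite (parentSite X) ≡ X
  parentSite²≢ (cyc✓ {zero} _) e rewrite m∸1≡suc[m∸2] = 0≢1+n (sym (trans (sym m∸2≡suc[m∸3]) (cyc-injective e)))
  parentSite²≢ (cyc✓ {suc zero} _) e =
    0≢1+n (sym (cong pred (trans (sym (trans m∸1≡suc[m∸2] (cong suc m∸2≡suc[m∸3]))) (cyc-injective e))))
  parentSite²≢ (cyc✓ {suc (suc i)} _) e = <-irrefl (cyc-injective e) (n≤1+n (suc i))
  parentSite²≢ (pathA✓ {zero} _) ()
  parentSite²≢ (pathA✓ {suc zero} _) ()
  parentSite²≢ (pathA✓ {suc (suc i)} _) ()
  parentSite²≢ (pathB✓ {zero} _) e with () ← trans (sym (parentSite-cyc h)) e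
  parentSite²≢ (pathB✓ {suc zero} _) ()
  parentSite²≢ (pathB✓ {suc (suc i)} _) ()
  parentSite²≢ (pend✓ _) ()

  parent≢ : ∀ v → v < n → ¬ parent v ≡ v
  parent≢ v v<n e = parentSite≢ (site-valid v v<n) (trans (sym (site-parent v v<n)) (cong site e))

  parent²≢ : ∀ v → v < n → ¬ parent (parent v) ≡ v
  parent²≢ v v<n e = parentSite²≢ (site-valid v v<n)
    (trans (cong parentSite (sym (site-parent v v<n)))
      (trans (sym (site-parent (parent v) (parent<n v v<n))) (cong site e)))

  private
    ≡ᵇ-false⇒≢ : ∀ {x y} → (x ≡ᵇ y) ≡ false → ¬ x ≡ y
    ≡ᵇ-false⇒≢ {x} e refl with () ← trans (sym (≡ᵇ-refl x)) e

  adj≡ : ∀ x y → x < n → y < n → adj graphU x y ≡ ((parent y ≡ᵇ x) ∨ (parent x ≡ᵇ y))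
  adj≡ x y x<n y<n with parent y ≡ᵇ x in py≡x
  ... | true = subst (λ z → adj graphU z y ≡ true) (≡ᵇ-true⇒≡ py≡x) (adj-parent-child y y<n)
  ... | false with parent x ≡ᵇ y in px≡y
  ...   | true = subst (λ z → adj graphU x z ≡ true) (≡ᵇ-true⇒≡ px≡y) (adj-child-parent x x<n)
  ...   | false with adj graphU x y in xy
  ...     | false = refl
  ...     | true with adj⇒parent x y xy
  ...       | inj₁ e = ⊥-elim (≡ᵇ-false⇒≢ py≡x e)
  ...       | inj₂ e = ⊥-elim (≡ᵇ-false⇒≢ px≡y e)

  parent-edge-once : ∀ x y → y < n → (parent y ≡ᵇ x) ≡ true → (parent x ≡ᵇ y) ≡ false
  parent-edge-once x y y<n py≡x with parent x ≡ᵇ y in px≡y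
  ... | false = refl
  ... | true = ⊥-elim (parent²≢ y y<n (trans (cong parent (≡ᵇ-true⇒≡ py≡x)) (≡ᵇ-true⇒≡ px≡y)))

  ∑-parent : ∀ (f : ℕ → ℕ) x → x < n → ∑[ y < n ] (⟦ parent x ≡ᵇ y ⟧ * f y) ≡ f (parent x)
  ∑-parent f x x<n =
    trans (∑-cong n (λ y _ → cong (λ z → ⟦ z ⟧ * f y) (≡ᵇ-sym (parent x) y))) (∑-indicator f (parent x) n (parent<n x x<n))

  children : ℕ → ℕ
  children x = ∑[ y < n ] ⟦ parent y ≡ᵇ x ⟧

  degree≡ : ∀ x → x < n → degree graphU x ≡ suc (children x)
  degree≡ x x<n = begin
      degree graphU x
    ≡⟨ countB-applyUpTo (adj graphU x) (λ i → i) n ⟩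
      ∑[ y < n ] ⟦ adj graphU x y ⟧
    ≡⟨ ∑-cong n (λ y y<n → trans (cong ⟦_⟧ (adj≡ x y x<n y<n)) (⟦∨⟧ _ _ (parent-edge-once x y y<n))) ⟩
      ∑[ y < n ] (⟦ parent y ≡ᵇ x ⟧ + ⟦ parent x ≡ᵇ y ⟧)
    ≡⟨ ∑-distrib-+ _ _ n ⟩
      children x + ∑[ y < n ] ⟦ parent x ≡ᵇ y ⟧
    ≡⟨ cong (children x +_) (trans (∑-cong n (λ y _ → sym (*-identityʳ _))) (∑-parent (λ _ → 1) x x<n)) ⟩
      children x + 1
    ≡⟨ +-comm (children x) 1 ⟩
      suc (children x) ∎
    where open ≡-Reasoning

  edgeCount≡n : edgeCount graphU ≡ n
  edgeCount≡n = begin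
      edgeCount graphU
    ≡⟨ sum-map-upTo _ n ⟩
      ∑[ x < n ] countB (λ y → (x <ᵇ y) ∧ adj graphU x y) (upTo n)
    ≡⟨ ∑-cong n (λ x x<n → trans (countB-applyUpTo _ (λ i → i) n) (∑-cong n (λ y y<n →
         trans (cong (λ z → ⟦ (x <ᵇ y) ∧ z ⟧) (adj≡ x y x<n y<n)) (⟦∧∨⟧ (x <ᵇ y) _ _ (parent-edge-once x y y<n))))) ⟩
      ∑[ x < n ] ∑[ y < n ] (⟦ parent y ≡ᵇ x ⟧ * ⟦ x <ᵇ y ⟧ + ⟦ parent x ≡ᵇ y ⟧ * ⟦ x <ᵇ y ⟧)
    ≡⟨ trans (∑-cong n (λ x _ → ∑-distrib-+ _ _ n)) (∑-distrib-+ _ _ n) ⟩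
      ∑[ x < n ] ∑[ y < n ] (⟦ parent y ≡ᵇ x ⟧ * ⟦ x <ᵇ y ⟧) + ∑[ x < n ] ∑[ y < n ] (⟦ parent x ≡ᵇ y ⟧ * ⟦ x <ᵇ y ⟧)
    ≡⟨ cong (_+ ∑[ x < n ] ∑[ y < n ] (⟦ parent x ≡ᵇ y ⟧ * ⟦ x <ᵇ y ⟧)) (∑-comm (λ x y → ⟦ parent y ≡ᵇ x ⟧ * ⟦ x <ᵇ y ⟧) n n) ⟩
      ∑[ y < n ] ∑[ x < n ] (⟦ parent y ≡ᵇ x ⟧ * ⟦ x <ᵇ y ⟧) + ∑[ x < n ] ∑[ y < n ] (⟦ parent x ≡ᵇ y ⟧ * ⟦ x <ᵇ y ⟧)
    ≡⟨ cong₂ _+_ (∑-cong n (λ y y<n → ∑-parent (λ x → ⟦ x <ᵇ y ⟧) y y<n)) (∑-cong n (λ x x<n → ∑-parent (λ y → ⟦ x <ᵇ y ⟧) x x<n)) ⟩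
      ∑[ v < n ] ⟦ parent v <ᵇ v ⟧ + ∑[ v < n ] ⟦ v <ᵇ parent v ⟧
    ≡⟨ sym (∑-distrib-+ _ _ n) ⟩
      ∑[ v < n ] (⟦ parent v <ᵇ v ⟧ + ⟦ v <ᵇ parent v ⟧)
    ≡⟨ ∑-cong n (λ v v<n → ⟦<ᵇ⟧+⟦>ᵇ⟧≡1 (parent v) v (parent≢ v v<n)) ⟩
      ∑[ _ < n ] 1
    ≡⟨ trans (∑-const 1 n) (*-identityʳ n) ⟩
      n ∎
    where open ≡-Reasoning

  siteTransmission : Site → ℕ
  siteTransmission X = ∑[ y < n ] siteDist X (site y)

  transmission≡ : ∀ x → x < n → transmission graphU x ≡ siteTransmission (site x)
  transmission≡ x x<n = trans (sum-map-upTo (dist graphU x) n) (∑-cong n (λ y y<n → dist≡δ x y x<n y<n))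

  -- Each edge {parent y, y} is counted once more, from its child y.
  degreeDistance≡∑parent : degreeDistance graphU ≡ ∑[ v < n ] (siteTransmission (site v) + siteTransmission (parentSite (site v)))
  degreeDistance≡∑parent = begin
      degreeDistance graphU
    ≡⟨ sum-map-upTo _ n ⟩
      ∑[ x < n ] (degree graphU x * transmission graphU x)
    ≡⟨ ∑-cong n (λ x x<n → cong₂ _*_ (degree≡ x x<n) (transmission≡ x x<n)) ⟩
      ∑[ x < n ] (D x + children x * D x)
    ≡⟨ ∑-distrib-+ _ _ n ⟩
      ∑ D n + ∑[ x < n ] (children x * D x)
    ≡⟨ cong (∑ D n +_) (∑-cong n (λ x _ → ∑-distribʳ-* (λ y → ⟦ parent y ≡ᵇ x ⟧) n (D x))) ⟩
      ∑ D n + ∑[ x < n ] ∑[ y < n ] (⟦ parent y ≡ᵇ x ⟧ * D x)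
    ≡⟨ cong (∑ D n +_) (∑-comm (λ x y → ⟦ parent y ≡ᵇ x ⟧ * D x) n n) ⟩
      ∑ D n + ∑[ y < n ] ∑[ x < n ] (⟦ parent y ≡ᵇ x ⟧ * D x)
    ≡⟨ cong (∑ D n +_) (∑-cong n (λ y y<n → ∑-parent D y y<n)) ⟩
      ∑ D n + ∑[ y < n ] D (parent y)
    ≡⟨ sym (∑-distrib-+ _ _ n) ⟩
      ∑[ v < n ] (D v + D (parent v))
    ≡⟨ ∑-cong n (λ v v<n → cong (λ Z → D v + siteTransmission Z) (site-parent v v<n)) ⟩
      ∑[ v < n ] (siteTransmission (site v) + siteTransmission (parentSite (site v))) ∎
    where
    open ≡-Reasoning
    D : ℕ → ℕ
    D v = siteTransmission (site v)

  ∑-sites : ∀ (g : Site → ℕ) → ∑[ y < n ] g (site y) ≡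
    ∑[ i < m ] g (cyc i) + ∑[ i < a ] g (pathA (suc i)) + ∑[ i < b ] g (pathB (suc i)) + ∑[ j < q ] g (pend j)
  ∑-sites g = begin
      ∑ f (m + a + b + q)
    ≡⟨ ∑-split f (m + a + b) q ⟩
      ∑ f (m + a + b) + ∑[ j < q ] f (m + a + b + j)
    ≡⟨ cong (_+ ∑[ j < q ] f (m + a + b + j)) (∑-split f (m + a) b) ⟩
      ∑ f (m + a) + ∑[ i < b ] f (m + a + i) + ∑[ j < q ] f (m + a + b + j)
    ≡⟨ cong (λ z → z + ∑[ i < b ] f (m + a + i) + ∑[ j < q ] f (m + a + b + j)) (∑-split f m a) ⟩
      ∑ f m + ∑[ i < a ] f (m + i) + ∑[ i < b ] f (m + a + i) + ∑[ j < q ] f (m + a + b + j)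
    ≡⟨ cong₂ _+_ (cong₂ _+_ (cong₂ _+_ (∑-cong m (λ i i<m → cong g (site-cyc i<m))) (∑-cong a (λ i i<a → cong g (site-pathA i<a))))
                            (∑-cong b (λ i i<b → cong g (site-pathB i<b))))
                 (∑-cong q (λ j _ → cong g (site-pend j))) ⟩
      ∑[ i < m ] g (cyc i) + ∑[ i < a ] g (pathA (suc i)) + ∑[ i < b ] g (pathB (suc i)) + ∑[ j < q ] g (pend j) ∎
    where
    open ≡-Reasoning
    f : ℕ → ℕ
    f y = g (site y)

  pathASum pathBSum pendantSum : ℕ → ℕ
  pathASum s = ∑[ t < a ] ∣ s - suc t ∣
  pathBSum s = ∑[ t < b ] ∣ s - suc t ∣
  pendantSum j = ∑[ k < q ] (if j ≡ᵇ k then 0 else 2)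

  private
    ∑cdist+ : ∀ c i → i < m → ∑[ j < m ] (c + cdist i j) ≡ m * c + cycleSum
    ∑cdist+ c i i<m = trans (∑-+ˡ (cdist i) c m) (cong (m * c +_) (∑cdist≡cycleSum i i<m))

    ∑path+ : ∀ s c k → ∑[ t < k ] (s + suc t + c) ≡ Δ⁺ k + k * (s + c)
    ∑path+ s c k = trans (∑-cong k (λ t _ → regroup t)) (∑-+ʳ suc (s + c) k)
      where
      regroup : ∀ t → s + suc t + c ≡ suc t + (s + c)
      regroup t = trans (cong (_+ c) (+-comm s (suc t))) (+-assoc (suc t) s c)

  siteTransmission-cyc : ∀ i → i < m →
    siteTransmission (cyc i) ≡ cycleSum + (Δ⁺ a + a * cdist i 0) + (Δ⁺ b + b * cdist i h) + q * suc (cdist i 0)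
  siteTransmission-cyc i i<m = trans (∑-sites (siteDist (cyc i)))
    (cong₂ _+_ (cong₂ _+_ (cong₂ _+_ (∑cdist≡cycleSum i i<m) (∑-+ʳ suc (cdist i 0) a)) (∑-+ʳ suc (cdist i h) b))
               (∑-const (suc (cdist i 0)) q))

  siteTransmission-pathA : ∀ s →
    siteTransmission (pathA s) ≡ m * (s + 0) + cycleSum + pathASum s + (Δ⁺ b + b * (s + h)) + q * (s + 1 + 0)
  siteTransmission-pathA s = trans (∑-sites (siteDist (pathA s)))
    (cong₂ _+_ (cong₂ _+_ (cong (_+ pathASum s) (∑cdist+ (s + 0) 0 0<m))
                          (trans (∑path+ s (cdist 0 h) b) (cong (λ z → Δ⁺ b + b * (s + z)) cdist-0-h)))
               (∑-const (s + 1 + 0) q))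

  siteTransmission-pathB : ∀ s →
    siteTransmission (pathB s) ≡ m * (s + 0) + cycleSum + (Δ⁺ a + a * (s + h)) + pathBSum s + q * (s + 1 + h)
  siteTransmission-pathB s = trans (∑-sites (siteDist (pathB s)))
    (cong₂ _+_ (cong (_+ pathBSum s) (cong₂ _+_ (∑cdist+ (s + 0) h h<m)
                                                 (trans (∑path+ s (cdist h 0) a) (cong (λ z → Δ⁺ a + a * (s + z)) cdist-h-0))))
               (trans (∑-const (s + 1 + cdist h 0) q) (cong (λ z → q * (s + 1 + z)) cdist-h-0)))

  siteTransmission-pend : ∀ j →
    siteTransmission (pend j) ≡ m * 1 + cycleSum + (Δ⁺ a + a * 1) + (Δ⁺ b + b * (1 + h)) + pendantSum j
  siteTransmission-pend j = trans (∑-sites (siteDist (pend j)))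
    (cong (_+ pendantSum j) (cong₂ _+_ (cong₂ _+_ (∑cdist+ 1 0 0<m) (∑path+ 1 0 a))
                                       (trans (∑path+ 1 (cdist 0 h) b) (cong (λ z → Δ⁺ b + b * (1 + z)) cdist-0-h))))

  ∑pendantSum+2q≡2q² : ∑[ j < q ] pendantSum j + 2 * q ≡ 2 * q * q
  ∑pendantSum+2q≡2q² = begin
      ∑[ j < q ] pendantSum j + 2 * q
    ≡⟨ cong (∑ pendantSum q +_) (sym (trans (∑-const 2 q) (*-comm q 2))) ⟩
      ∑[ j < q ] pendantSum j + ∑[ _ < q ] 2
    ≡⟨ sym (∑-distrib-+ pendantSum (λ _ → 2) q) ⟩
      ∑[ j < q ] (pendantSum j + 2)
    ≡⟨ ∑-cong q (λ j j<q → pendantSum+2 j j<q) ⟩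
      ∑[ _ < q ] (2 * q)
    ≡⟨ trans (∑-const (2 * q) q) (*-comm q (2 * q)) ⟩
      2 * q * q ∎
    where
    open ≡-Reasoning
    pendantSum+2 : ∀ j → j < q → pendantSum j + 2 ≡ 2 * q
    pendantSum+2 j j<q = begin
        pendantSum j + 2
      ≡⟨ cong (pendantSum j +_) (sym (∑-indicator (λ _ → 2) j q j<q)) ⟩
        pendantSum j + ∑[ k < q ] (⟦ k ≡ᵇ j ⟧ * 2)
      ≡⟨ sym (∑-distrib-+ _ _ q) ⟩
        ∑[ k < q ] ((if j ≡ᵇ k then 0 else 2) + ⟦ k ≡ᵇ j ⟧ * 2)
      ≡⟨ ∑-cong q (λ k _ → cong (λ t → (if j ≡ᵇ k then 0 else 2) + ⟦ t ⟧ * 2) (≡ᵇ-sym k j)) ⟩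
        ∑[ k < q ] ((if j ≡ᵇ k then 0 else 2) + ⟦ j ≡ᵇ k ⟧ * 2)
      ≡⟨ ∑-cong q (λ k _ → complementary (j ≡ᵇ k)) ⟩
        ∑[ _ < q ] 2
      ≡⟨ trans (∑-const 2 q) (*-comm q 2) ⟩
        2 * q ∎
      where
      complementary : ∀ t → (if t then 0 else 2) + ⟦ t ⟧ * 2 ≡ 2
      complementary true = refl
      complementary false = refl

  ∑-prev : ∀ (f : ℕ → ℕ) → ∑[ i < m ] f (prev i) ≡ ∑ f m
  ∑-prev f = begin
      ∑[ i < m ] f (prev i)          ≡⟨ cong (∑ (λ i → f (prev i))) m≡1+[m∸1] ⟩
      f (m ∸ 1) + ∑ f (m ∸ 1)         ≡⟨ +-comm (f (m ∸ 1)) _ ⟩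
      ∑ f (m ∸ 1) + f (m ∸ 1)         ≡⟨ sym (∑-snoc f (m ∸ 1)) ⟩
      ∑ f (suc (m ∸ 1))               ≡⟨ cong (∑ f) (sym m≡1+[m∸1]) ⟩
      ∑ f m                           ∎
    where
    open ≡-Reasoning
    m≡1+[m∸1] : m ≡ suc (m ∸ 1)
    m≡1+[m∸1] = +-∸-assoc 1 0<m

  ∑-siteTransmission-cyc : ∑[ i < m ] siteTransmission (cyc i) ≡ cycleTotal m cycleSum a b q (Δ⁺ a) (Δ⁺ b)
  ∑-siteTransmission-cyc = begin
      ∑[ i < m ] siteTransmission (cyc i)
    ≡⟨ ∑-cong m (λ i i<m → trans (siteTransmission-cyc i i<m) (regroup cycleSum (Δ⁺ a) (Δ⁺ b) a b q (cdist i 0) (cdist i h))) ⟩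
      ∑[ i < m ] (c + ((a + q) * cdist i 0 + b * cdist i h))
    ≡⟨ ∑-+ˡ _ c m ⟩
      m * c + ∑[ i < m ] ((a + q) * cdist i 0 + b * cdist i h)
    ≡⟨ cong (m * c +_) (∑-distrib-+ _ _ m) ⟩
      m * c + (∑[ i < m ] ((a + q) * cdist i 0) + ∑[ i < m ] (b * cdist i h))
    ≡⟨ cong (m * c +_) (cong₂ _+_ (∑-distribˡ-* (a + q) (λ i → cdist i 0) m) (∑-distribˡ-* b (λ i → cdist i h) m)) ⟩
      m * c + ((a + q) * ∑[ i < m ] cdist i 0 + b * ∑[ i < m ] cdist i h)
    ≡⟨ cong (m * c +_) (cong₂ (λ u v → (a + q) * u + b * v) (∑cdist-to 0 0<m) (∑cdist-to h h<m)) ⟩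
      m * c + ((a + q) * cycleSum + b * cycleSum) ∎
    where
    open ≡-Reasoning
    c = cycleSum + Δ⁺ a + Δ⁺ b + q
    regroup : ∀ W Ta Tb a b q x y → W + (Ta + a * x) + (Tb + b * y) + q * suc x ≡ (W + Ta + Tb + q) + ((a + q) * x + b * y)
    regroup = solve-∀
    ∑cdist-to : ∀ j → j < m → ∑[ i < m ] cdist i j ≡ cycleSum
    ∑cdist-to j j<m = trans (∑-cong m (λ i _ → cdist-sym i j)) (∑cdist≡cycleSum j j<m)

  cycle-contribution : ∑[ i < m ] (siteTransmission (cyc i) + siteTransmission (parentSite (cyc i)))
                     ≡ cycleTotal m cycleSum a b q (Δ⁺ a) (Δ⁺ b) + cycleTotal m cycleSum a b q (Δ⁺ a) (Δ⁺ b)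
  cycle-contribution = begin
      ∑[ i < m ] (siteTransmission (cyc i) + siteTransmission (parentSite (cyc i)))
    ≡⟨ ∑-distrib-+ _ _ m ⟩
      ∑[ i < m ] siteTransmission (cyc i) + ∑[ i < m ] siteTransmission (parentSite (cyc i))
    ≡⟨ cong (∑[ i < m ] siteTransmission (cyc i) +_)
            (trans (∑-cong m (λ i _ → cong siteTransmission (parentSite-cyc i))) (∑-prev (λ j → siteTransmission (cyc j)))) ⟩
      ∑[ i < m ] siteTransmission (cyc i) + ∑[ i < m ] siteTransmission (cyc i)
    ≡⟨ cong (λ z → z + z) ∑-siteTransmission-cyc ⟩
      cycleTotal m cycleSum a b q (Δ⁺ a) (Δ⁺ b) + cycleTotal m cycleSum a b q (Δ⁺ a) (Δ⁺ b) ∎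
    where open ≡-Reasoning

  pathA-contribution : ∑[ i < a ] (siteTransmission (pathA (suc i)) + siteTransmission (parentSite (pathA (suc i))))
                     ≡ pathAPart m cycleSum h a b q (Δ a) (Δ⁺ b) (absDiffSum a) (absDiffSum⁺ a)
  pathA-contribution = trans
    (∑-cong a (λ i _ → trans (cong₂ _+_ (siteTransmission-pathA (suc i)) (parent-transmission i))
                             (regroup m cycleSum h b q (Δ⁺ b) i (pathASum i) (pathASum (suc i)))))
    (∑-affine (λ i → pathASum (suc i)) pathASum (m + 2 * cycleSum + 2 * Δ⁺ b + b + 2 * b * h + 3 * q) (2 * m + 2 * b + 2 * q) a)
    where
    P : ℕ → ℕ
    P s = m * (s + 0) + cycleSum + pathASum s + (Δ⁺ b + b * (s + h)) + q * (s + 1 + 0)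
    attach : ∀ m W Ta Tb a b q h → W + (Ta + a * 0) + (Tb + b * h) + q * 1
                                   ≡ m * (0 + 0) + W + Ta + (Tb + b * (0 + h)) + q * (0 + 1 + 0)
    attach = solve-∀
    parent-transmission : ∀ i → siteTransmission (parentSite (pathA (suc i))) ≡ P i
    parent-transmission zero = trans (siteTransmission-cyc 0 0<m)
      (trans (cong (λ z → cycleSum + (Δ⁺ a + a * 0) + (Δ⁺ b + b * z) + q * 1) cdist-0-h) (attach m cycleSum (Δ⁺ a) (Δ⁺ b) a b q h))
    parent-transmission (suc i) = siteTransmission-pathA (suc i)
    regroup : ∀ m W h b q Tb i x y →
      (m * (suc i + 0) + W + y + (Tb + b * (suc i + h)) + q * (suc i + 1 + 0)) + (m * (i + 0) + W + x + (Tb + b * (i + h)) + q * (i + 1 + 0))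
      ≡ (m + 2 * W + 2 * Tb + b + 2 * b * h + 3 * q) + (2 * m + 2 * b + 2 * q) * i + (y + x)
    regroup = solve-∀

  pathB-contribution : ∑[ i < b ] (siteTransmission (pathB (suc i)) + siteTransmission (parentSite (pathB (suc i))))
                     ≡ pathBPart m cycleSum h a b q (Δ⁺ a) (Δ b) (absDiffSum b) (absDiffSum⁺ b)
  pathB-contribution = trans
    (∑-cong b (λ i _ → trans (cong₂ _+_ (siteTransmission-pathB (suc i)) (parent-transmission i))
                             (regroup m cycleSum h a q (Δ⁺ a) i (pathBSum i) (pathBSum (suc i)))))
    (∑-affine (λ i → pathBSum (suc i)) pathBSum (m + 2 * cycleSum + 2 * Δ⁺ a + a + 2 * a * h + 3 * q + 2 * q * h)
              (2 * m + 2 * a + 2 * q) b)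
    where
    P : ℕ → ℕ
    P s = m * (s + 0) + cycleSum + (Δ⁺ a + a * (s + h)) + pathBSum s + q * (s + 1 + h)
    attach : ∀ m W Ta Tb a b q h → W + (Ta + a * h) + (Tb + b * 0) + q * suc h
                                   ≡ m * (0 + 0) + W + (Ta + a * (0 + h)) + Tb + q * (0 + 1 + h)
    attach = solve-∀
    parent-transmission : ∀ i → siteTransmission (parentSite (pathB (suc i))) ≡ P i
    parent-transmission zero = trans (siteTransmission-cyc h h<m)
      (trans (cong₂ (λ z w → cycleSum + (Δ⁺ a + a * z) + (Δ⁺ b + b * w) + q * suc z) cdist-h-0 (cdist-self h))
             (attach m cycleSum (Δ⁺ a) (Δ⁺ b) a b q h))
    parent-transmission (suc i) = siteTransmission-pathB (suc i)
    regroup : ∀ m W h a q Ta i x y →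
      (m * (suc i + 0) + W + (Ta + a * (suc i + h)) + y + q * (suc i + 1 + h)) + (m * (i + 0) + W + (Ta + a * (i + h)) + x + q * (i + 1 + h))
      ≡ (m + 2 * W + 2 * Ta + a + 2 * a * h + 3 * q + 2 * q * h) + (2 * m + 2 * a + 2 * q) * i + (y + x)
    regroup = solve-∀

  pendant-contribution : ∑[ j < q ] (siteTransmission (pend j) + siteTransmission (parentSite (pend j)))
                       ≡ pendantPart m cycleSum h a b q (Δ⁺ a) (Δ⁺ b) (∑ pendantSum q)
  pendant-contribution = trans
    (∑-cong q (λ j _ → trans (cong₂ _+_ (siteTransmission-pend j) (siteTransmission-cyc 0 0<m))
      (trans (cong (λ z → (m * 1 + cycleSum + (Δ⁺ a + a * 1) + (Δ⁺ b + b * (1 + h)) + pendantSum j)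
                          + (cycleSum + (Δ⁺ a + a * 0) + (Δ⁺ b + b * z) + q * 1)) cdist-0-h)
             (regroup m cycleSum (Δ⁺ a) (Δ⁺ b) a b q h (pendantSum j)))))
    (∑-+ˡ pendantSum (m + 2 * cycleSum + 2 * Δ⁺ a + a + 2 * Δ⁺ b + b + 2 * b * h + q) q)
    where
    regroup : ∀ m W Ta Tb a b q h P →
      (m * 1 + W + (Ta + a * 1) + (Tb + b * (1 + h)) + P) + (W + (Ta + a * 0) + (Tb + b * h) + q * 1)
      ≡ (m + 2 * W + 2 * Ta + a + 2 * Tb + b + 2 * b * h + q) + P
    regroup = solve-∀

  degreeDistance≡formula : degreeDistance graphU ≡
    degreeDistanceFormula m cycleSum h a b q (Δ a) (Δ⁺ a) (absDiffSum a) (absDiffSum⁺ a)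
                                             (Δ b) (Δ⁺ b) (absDiffSum b) (absDiffSum⁺ b) (∑ pendantSum q)
  degreeDistance≡formula =
    trans degreeDistance≡∑parent
      (trans (∑-sites (λ X → siteTransmission X + siteTransmission (parentSite X)))
        (cong₂ _+_ (cong₂ _+_ (cong₂ _+_ cycle-contribution pathA-contribution) pathB-contribution) pendant-contribution))

  3degreeDistance+6q≡ddPoly : 3 * degreeDistance graphU + 6 * q ≡ ddPoly h r a b q
  3degreeDistance+6q≡ddPoly =
    trans (cong (λ D → 3 * D + 6 * q) degreeDistance≡formula)
      (trans (closedForm-identity {m} {cycleSum} {h} {a} {b} {q} (Δ⁺≡Δ+ a) (absDiffSum⁺≡ a) (Δ⁺≡Δ+ b) (absDiffSum⁺≡ b))
             (closedForm≡ddPoly {h} {r} {a} {b} {q} (cycleSum≡ h r 1≤h r≤1) (2Δ+k≡k² a) (3absDiffSum+k≡k³ a)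
                                (2Δ+k≡k² b) (3absDiffSum+k≡k³ b) ∑pendantSum+2q≡2q²))

m-n<o-p : ∀ A B C E → A + E < C + B → ℤ.+ A ℤ.- ℤ.+ B <ℤ ℤ.+ C ℤ.- ℤ.+ E
m-n<o-p A B C E lt =
  subst₂ _<ℤ_ (cancel (ℤ.+ A) (ℤ.+ B) (ℤ.+ E)) (cancel′ (ℤ.+ C) (ℤ.+ B) (ℤ.+ E))
    (ℤ.+-monoˡ-< (ℤ.- ℤ.+ B ℤ.+ ℤ.- ℤ.+ E) (subst₂ _<ℤ_ (ℤ.pos-+ A E) (ℤ.pos-+ C B) (ℤ.+<+ lt)))
  where
  cancel : ∀ x y w → (x ℤ.+ w) ℤ.+ (ℤ.- y ℤ.+ ℤ.- w) ≡ x ℤ.- y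
  cancel = solve-∀ℤ
  cancel′ : ∀ z y w → (z ℤ.+ y) ℤ.+ (ℤ.- y ℤ.+ ℤ.- w) ≡ z ℤ.- w
  cancel′ = solve-∀ℤ

-- The hypothesis is ddPoly-gap with each polynomial replaced by 3 D' + 6q.
degreeDistance-trade : ∀ {N′ N d D₁ D₂ q g} →
  (3 * D₂ + 6 * q) + suc g ≡ 6 * N′ * N + (3 * D₁ + 6 * q) →
  2 * N′ * N * d + D₂ < 2 * N′ * N * suc d + D₁
degreeDistance-trade {N′} {N} {d} {D₁} {D₂} {q} {g} gap =
  *-cancelˡ-< 3 _ _ (+-cancelʳ-< (6 * q) _ _ (subst (L <_) L+g≡R (m<m+n L z<s)))
  where
  open ≡-Reasoning
  L = 3 * (2 * N′ * N * d + D₂) + 6 * q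
  L+g≡R : L + suc g ≡ 3 * (2 * N′ * N * suc d + D₁) + 6 * q
  L+g≡R = begin
      L + suc g                                          ≡⟨ regroup N′ N d D₂ q (suc g) ⟩
      6 * N′ * N * d + ((3 * D₂ + 6 * q) + suc g)        ≡⟨ cong (6 * N′ * N * d +_) gap ⟩
      6 * N′ * N * d + (6 * N′ * N + (3 * D₁ + 6 * q))   ≡⟨ regroup′ N′ N d D₁ q ⟩
      3 * (2 * N′ * N * suc d + D₁) + 6 * q              ∎
    where
    regroup : ∀ N′ N d D q g → 3 * (2 * N′ * N * d + D) + 6 * q + g ≡ 6 * N′ * N * d + ((3 * D + 6 * q) + g)
    regroup = solve-∀
    regroup′ : ∀ N′ N d D q → 6 * N′ * N * d + (6 * N′ * N + (3 * D + 6 * q)) ≡ 3 * (2 * N′ * N * suc d + D) + 6 * q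
    regroup′ = solve-∀

reverseDegreeDistance≡ : ∀ {G e d} → edgeCount G ≡ e → diameter G ≡ d →
  reverseDegreeDistance G ≡ ℤ.+ (2 * (order G ∸ 1) * e * d) ℤ.- ℤ.+ degreeDistance G
reverseDegreeDistance≡ refl refl = refl

reverseDegreeDistance-< : ∀ k r a b q → r ≤ 1 → 3 ≤ suc k + suc k + r → 1 ≤ a →
  reverseDegreeDistance (unicyclicGraph (2 + k + (2 + k) + r + a + b + q) (2 + k + (2 + k) + r) (2 + k) a b q)
  <ℤ reverseDegreeDistance (unicyclicGraph (1 + k + (1 + k) + r + (1 + a) + (1 + b) + q) (1 + k + (1 + k) + r) (1 + k) (1 + a) (1 + b) q)
reverseDegreeDistance-< k r a b q r≤1 3≤m 1≤a =
  subst₂ _<ℤ_ (sym (reverseDegreeDistance≡ {U₁.graphU} U₁.edgeCount≡n U₁.diameter≡diam))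
              (sym (reverseDegreeDistance≡ {U₂.graphU} U₂.edgeCount≡n U₂.diameter≡diam))
    (m-n<o-p (2 * (U₁.n ∸ 1) * U₁.n * U₁.diam) D₁ (2 * (U₂.n ∸ 1) * U₂.n * U₂.diam) D₂
      (subst₂ (λ N d → 2 * (U₁.n ∸ 1) * U₁.n * U₁.diam + D₂ < 2 * (N ∸ 1) * N * d + D₁)
              (sym n₂≡n₁) (sym diam₂≡1+diam₁)
              (degreeDistance-trade {U₁.n ∸ 1} {U₁.n} {U₁.diam} {D₁} {D₂} {q} {gapPoly k r a b q} traded)))
  where
  module U₁ = Unicyclic (2 + k) r a b q r≤1 (≤-trans 3≤m (+-monoˡ-≤ r (+-mono-≤ (n≤1+n (suc k)) (n≤1+n (suc k))))) 1≤a
  module U₂ = Unicyclic (1 + k) r (1 + a) (1 + b) q r≤1 3≤m (s≤s z≤n)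
  D₁ = degreeDistance U₁.graphU
  D₂ = degreeDistance U₂.graphU

  n₂≡n₁ : U₂.n ≡ U₁.n
  n₂≡n₁ = shift k r a b q
    where
    shift : ∀ k r a b q → 1 + k + (1 + k) + r + (1 + a) + (1 + b) + q ≡ 2 + k + (2 + k) + r + a + b + q
    shift = solve-∀

  diam₂≡1+diam₁ : U₂.diam ≡ suc U₁.diam
  diam₂≡1+diam₁ = shift k a b
    where
    shift : ∀ k a b → 1 + a + (1 + b) + (1 + k) ≡ suc (a + b + (2 + k))
    shift = solve-∀

  traded : (3 * D₂ + 6 * q) + suc (gapPoly k r a b q) ≡ 6 * (U₁.n ∸ 1) * U₁.n + (3 * D₁ + 6 * q)
  traded = begin
      (3 * D₂ + 6 * q) + suc (gapPoly k r a b q)                ≡⟨ cong (_+ suc (gapPoly k r a b q)) U₂.3degreeDistance+6q≡ddPoly ⟩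
      ddPoly (1 + k) r (1 + a) (1 + b) q + suc (gapPoly k r a b q) ≡⟨ ddPoly-gap k r a b q ⟩
      6 * (U₁.n ∸ 1) * U₁.n + ddPoly (2 + k) r a b q          ≡⟨ cong (6 * (U₁.n ∸ 1) * U₁.n +_) (sym U₁.3degreeDistance+6q≡ddPoly) ⟩
      6 * (U₁.n ∸ 1) * U₁.n + (3 * D₁ + 6 * q)                 ∎
    where open ≡-Reasoning

unicyclicGraph-cong : ∀ {n n′ m m′ h h′ a a′ b b′ q q′} → n ≡ n′ → m ≡ m′ → h ≡ h′ → a ≡ a′ → b ≡ b′ → q ≡ q′ →
                      unicyclicGraph n m h a b q ≡ unicyclicGraph n′ m′ h′ a′ b′ q′
unicyclicGraph-cong refl refl refl refl refl refl = refl

[h+h+r]/2≡h : ∀ h r → r ≤ 1 → (h + h + r) / 2 ≡ h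
[h+h+r]/2≡h zero zero _ = refl
[h+h+r]/2≡h zero (suc zero) _ = refl
[h+h+r]/2≡h zero (suc (suc r)) (s≤s ())
[h+h+r]/2≡h (suc h) r r≤1 = begin
    (suc h + suc h + r) / 2   ≡⟨ cong (_/ 2) (shift h r) ⟩
    (2 + (h + h + r)) / 2     ≡⟨ m/n≡1+[m∸n]/n {2 + (h + h + r)} {2} (s≤s (s≤s z≤n)) ⟩
    suc ((h + h + r) / 2)     ≡⟨ cong suc ([h+h+r]/2≡h h r r≤1) ⟩
    suc h                     ∎
  where
  open ≡-Reasoning
  shift : ∀ h r → suc h + suc h + r ≡ 2 + (h + h + r)
  shift = solve-∀

[h+h+r+1]/2≡h+r : ∀ h r → r ≤ 1 → (h + h + r + 1) / 2 ≡ h + r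
[h+h+r+1]/2≡h+r h zero _ = trans (cong (_/ 2) (shift h)) (trans ([h+h+r]/2≡h h 1 ≤-refl) (sym (+-identityʳ h)))
  where
  shift : ∀ h → h + h + 0 + 1 ≡ h + h + 1
  shift = solve-∀
[h+h+r+1]/2≡h+r h (suc zero) _ = trans (cong (_/ 2) (shift h)) (trans ([h+h+r]/2≡h (suc h) 0 z≤n) (+-comm 1 h))
  where
  shift : ∀ h → h + h + 1 + 1 ≡ suc h + suc h + 0
  shift = solve-∀
[h+h+r+1]/2≡h+r h (suc (suc r)) (s≤s ())

module Parameters (n m d a b : ℕ) (5≤m : 5 ≤ m) (3≤d : 3 ≤ d) (d≤n∸⌈m/2⌉ : d ≤ n ∸ ((m + 1) / 2))
                  (a+b+⌊m/2⌋≡d : a + b + m / 2 ≡ d) where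

  h = m / 2
  r = m % 2
  k = h ∸ 2
  q = n ∸ d ∸ ((m + 1) / 2)

  r≤1 : r ≤ 1
  r≤1 = ≤-pred (m%n<n m 2)

  m≡h+h+r : m ≡ h + h + r
  m≡h+h+r = trans (m≡m%n+[m/n]*n m 2) (regroup r h)
    where
    regroup : ∀ r h → r + h * 2 ≡ h + h + r
    regroup = solve-∀

  h≡2+k : h ≡ 2 + k
  h≡2+k = sym (m+[n∸m]≡n 2≤h)
    where
    2≤h : 2 ≤ h
    2≤h = ≮⇒≥ λ h<2 → 5≰3 (≤-trans 5≤m (≤-trans (≤-reflexive m≡h+h+r) (+-mono-≤ (+-mono-≤ (≤-pred h<2) (≤-pred h<2)) r≤1)))
      where
      5≰3 : ¬ 5 ≤ 3
      5≰3 (s≤s (s≤s (s≤s ())))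

  ⌈m/2⌉≡h+r : (m + 1) / 2 ≡ h + r
  ⌈m/2⌉≡h+r = trans (cong (λ z → (z + 1) / 2) m≡h+h+r) ([h+h+r+1]/2≡h+r h r r≤1)

  q≡ : q ≡ n ∸ (d + (h + r))
  q≡ = trans (cong (n ∸ d ∸_) ⌈m/2⌉≡h+r) (∸-+-assoc n d (h + r))

  n≡ : n ≡ 2 + k + (2 + k) + r + a + b + q
  n≡ = begin
      n                                   ≡⟨ sym (m+[n∸m]≡n d+h+r≤n) ⟩
      d + (h + r) + (n ∸ (d + (h + r)))   ≡⟨ cong₂ (λ x y → x + (h + r) + y) (sym a+b+⌊m/2⌋≡d) (sym q≡) ⟩
      a + b + h + (h + r) + q             ≡⟨ regroup a b h r q ⟩
      h + h + r + a + b + q               ≡⟨ cong (λ z → z + z + r + a + b + q) h≡2+k ⟩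
      2 + k + (2 + k) + r + a + b + q     ∎
    where
    open ≡-Reasoning
    regroup : ∀ a b h r q → a + b + h + (h + r) + q ≡ h + h + r + a + b + q
    regroup = solve-∀
    d≤n∸[h+r] : d ≤ n ∸ (h + r)
    d≤n∸[h+r] = subst (λ z → d ≤ n ∸ z) ⌈m/2⌉≡h+r d≤n∸⌈m/2⌉
    h+r≤n : h + r ≤ n
    h+r≤n = <⇒≤ (m∸n≢0⇒n<m λ n∸[h+r]≡0 → 3≰0 (≤-trans 3≤d (subst (d ≤_) n∸[h+r]≡0 d≤n∸[h+r])))
      where
      3≰0 : ¬ 3 ≤ 0
      3≰0 ()
    d+h+r≤n : d + (h + r) ≤ n
    d+h+r≤n = m≤o∸n⇒m+n≤o d h+r≤n d≤n∸[h+r]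

  m≡ : m ≡ 2 + k + (2 + k) + r
  m≡ = trans m≡h+h+r (cong (λ z → z + z + r) h≡2+k)

  m∸2≡ : m ∸ 2 ≡ 1 + k + (1 + k) + r
  m∸2≡ = trans (cong (_∸ 2) m≡) (regroup k r)
    where
    regroup : ∀ k r → k + (2 + k) + r ≡ 1 + k + (1 + k) + r
    regroup = solve-∀

  3≤m∸2 : 3 ≤ suc k + suc k + r
  3≤m∸2 = subst (3 ≤_) m∸2≡ (∸-monoˡ-≤ 2 5≤m)

  U≡ : U n m d a b ≡ unicyclicGraph (2 + k + (2 + k) + r + a + b + q) (2 + k + (2 + k) + r) (2 + k) a b q
  U≡ = unicyclicGraph-cong n≡ m≡ h≡2+k (refl {x = a}) (refl {x = b}) (refl {x = q})

  U′≡ : U n (m ∸ 2) (d + 1) (a + 1) (b + 1)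
      ≡ unicyclicGraph (1 + k + (1 + k) + r + (1 + a) + (1 + b) + q) (1 + k + (1 + k) + r) (1 + k) (1 + a) (1 + b) q
  U′≡ = unicyclicGraph-cong (trans n≡ (regroup k r a b q)) m∸2≡ (trans (cong (_/ 2) m∸2≡) ([h+h+r]/2≡h (1 + k) r r≤1))
                            (+-comm a 1) (+-comm b 1) q′≡q
    where
    regroup : ∀ k r a b q → 2 + k + (2 + k) + r + a + b + q ≡ 1 + k + (1 + k) + r + (1 + a) + (1 + b) + q
    regroup = solve-∀
    q′≡q : n ∸ (d + 1) ∸ ((m ∸ 2 + 1) / 2) ≡ q
    q′≡q = begin
        n ∸ (d + 1) ∸ ((m ∸ 2 + 1) / 2)
      ≡⟨ cong (λ z → n ∸ (d + 1) ∸ ((z + 1) / 2)) m∸2≡ ⟩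
        n ∸ (d + 1) ∸ ((1 + k + (1 + k) + r + 1) / 2)
      ≡⟨ cong (n ∸ (d + 1) ∸_) ([h+h+r+1]/2≡h+r (1 + k) r r≤1) ⟩
        n ∸ (d + 1) ∸ (1 + k + r)
      ≡⟨ ∸-+-assoc n (d + 1) (1 + k + r) ⟩
        n ∸ (d + 1 + (1 + k + r))
      ≡⟨ cong (n ∸_) (trans (regroup′ d k r) (cong (λ z → d + (z + r)) (sym h≡2+k))) ⟩
        n ∸ (d + (h + r))
      ≡⟨ sym q≡ ⟩
        q ∎
      where
      open ≡-Reasoning
      regroup′ : ∀ d k r → d + 1 + (1 + k + r) ≡ d + (2 + k + r)
      regroup′ = solve-∀

lemma11 : (n m d a b : ℕ) →
    5 ≤ m → m ≤ n ∸ 2 →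
    3 ≤ d → d ≤ n ∸ ((m + 1) / 2) →
    a + b + m / 2 ≡ d → a ≥ b → a ≥ 1 →
    reverseDegreeDistance (U n m d a b)
      <ℤ reverseDegreeDistance (U n (m ∸ 2) (d + 1) (a + 1) (b + 1))
lemma11 n m d a b 5≤m _ 3≤d d≤n∸⌈m/2⌉ a+b+⌊m/2⌋≡d _ 1≤a =
  subst₂ _<ℤ_ (cong reverseDegreeDistance (sym U≡)) (cong reverseDegreeDistance (sym U′≡))
    (reverseDegreeDistance-< k r a b q r≤1 3≤m∸2 1≤a)
  where open Parameters n m d a b 5≤m 3≤d d≤n∸⌈m/2⌉ a+b+⌊m/2⌋≡d
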